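{- Let $\alpha$ be a fixed partition and $n\ge0$. Then $$F_{n+1}^\alpha=\sum_{\nu\in\alpha^+}(-1)^{u(\nu,\alpha)}x^{v(\nu/\alpha)}y^{h(\nu/\alpha)}z^{d(\nu/\alpha)}F_n^\nu.$$
   Context: Partitions are identified with Young diagrams (cell $(i,j)$: row $i$, column $j$); for $\mu\subseteq\lambda$, $\lambda/\mu$ is the set of cells of $\lambda$ not in $\mu$, $\lambda/\mu\vdash n$ means it has $n$ cells. $v,h,d$ of a skew shape are its numbers of cells in even rows, in even columns, and in both even rows and even columns. Write $(i,j)\lhd(i',j')$ if $i<i'$ or ($i=i'$, $j<j'$). $\alpha^+$ is the set of partitions $\lambda\supseteq\alpha$ with $|\lambda|=|\alpha|+1$; for $\nu\in\alpha^+$ with $b$ the unique cell of $\nu/\alpha$, $u(\nu,\alpha)$ is the number of cells $a\in\alpha$ with $b\lhd a$. A standard Young tableau (SYT) of shape $\lambda/\mu\vdash n$ is a bijection $T$ from its cells to $[n]$ increasing along rows and columns. For $T$ of straight shape, ${\rm sign}(T)=(-1)^{\#\{(a,b):a\lhd b,\,T(a)>T(b)\}}$. For $T_1$ of shape $\nu/\mu\vdash k$ and $T_2$ of shape $\lambda/\nu$, $T_1\diamond T_2$ equals $T_1$ on $\nu/\mu$ and $T_2+k$ on $\lambda/\nu$. For $T$ of shape $\lambda/\mu$, ${\rm sign}(T)={\rm sign}(T_0){\rm sign}(T_0\diamond T)$ for any SYT $T_0$ of shape $\mu$; $I_{\lambda/\mu}=\sum_T{\rm sign}(T)$. For $n\ge0$,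 $F_n^\alpha=\sum_{\lambda:\ \lambda/\alpha\vdash n}x^{v(\lambda/\alpha)}y^{h(\lambda/\alpha)}z^{d(\lambda/\alpha)}I_{\lambda/\alpha}$. -}

module Defs where

open import Data.Bool using (Bool; true; false; _∧_; _∨_; not; if_then_else_)
open import Data.Nat using (ℕ; zero; suc; _+_; _*_; _∸_; _≤_; _<_; _≡ᵇ_; _<ᵇ_; _⊓_)
open import Data.Nat.Properties using ()
open import Data.Integer as ℤ using (ℤ; +_)
open import Data.List using (List; []; _∷_; _++_; map; concatMap; foldr; length; zip)
open import Data.Nat.ListAction using (sum)
open import Data.List.Relation.Unary.Linked using (Linked)
open import Data.List.Relation.Unary.All using (All)
open import Relation.Binary.PropositionalEquality using (_≡_)
open import Data.Product using (_×_; _,_; proj₁; proj₂)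

IsPartition : List ℕ → Set
IsPartition λ' = Linked (λ a b → b ≤ a) λ' × All (λ a → 0 < a) λ'

size : List ℕ → ℕ
size = sum

-- length of row i (rows indexed from 1); 0 outside
rowLen : List ℕ → ℕ → ℕ
rowLen []       _             = 0
rowLen (r ∷ rs) zero          = 0
rowLen (r ∷ rs) (suc zero)    = r
rowLen (r ∷ rs) (suc (suc i)) = rowLen rs (suc i)

_⊆ᵇ_ : List ℕ → List ℕ → Bool
[]       ⊆ᵇ _        = true
(a ∷ as) ⊆ᵇ []       = (a ≡ᵇ 0) ∧ (as ⊆ᵇ [])
(a ∷ as) ⊆ᵇ (b ∷ bs) = ((a <ᵇ b) ∨ (a ≡ᵇ b)) ∧ (as ⊆ᵇ bs)

bfilter : {A : Set} → (A → Bool) → List A → List A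
bfilter p []       = []
bfilter p (x ∷ xs) = if p x then x ∷ bfilter p xs else bfilter p xs

range : ℕ → ℕ → List ℕ
range a zero    = []
range a (suc k) = a ∷ range (suc a) k

-- all partitions of m with parts ≤ k (fuel f ≥ m suffices)
partsB : ℕ → ℕ → ℕ → List (List ℕ)
partsB _       zero    _ = [] ∷ []
partsB zero    (suc m) _ = []
partsB (suc f) (suc m) k =
  concatMap (λ p → map (p ∷_) (partsB f (suc m ∸ p) p)) (range 1 (suc m ⊓ k))

partitionsOf : ℕ → List (List ℕ)
partitionsOf m = partsB m m m

shapes : List ℕ → ℕ → List (List ℕ)
shapes α n = bfilter (α ⊆ᵇ_) (partitionsOf (size α + n))

plus : List ℕ → List (List ℕ)
plus α = shapes α 1

-- Cells (i , j): row i, column j, both indexed from 1.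

Cell : Set
Cell = ℕ × ℕ

_≤ᵇ_ : ℕ → ℕ → Bool
a ≤ᵇ b = (a <ᵇ b) ∨ (a ≡ᵇ b)

_==ᶜ_ : Cell → Cell → Bool
(i , j) ==ᶜ (i' , j') = (i ≡ᵇ i') ∧ (j ≡ᵇ j')

_◁_ : Cell → Cell → Bool
(i , j) ◁ (i' , j') = (i <ᵇ i') ∨ ((i ≡ᵇ i') ∧ (j <ᵇ j'))

inShape : List ℕ → Cell → Bool
inShape μ (i , j) = (1 ≤ᵇ i) ∧ (1 ≤ᵇ j) ∧ (j ≤ᵇ rowLen μ i)

cellsFrom : ℕ → List ℕ → List Cell
cellsFrom i []       = []
cellsFrom i (r ∷ rs) = map (i ,_) (range 1 r) ++ cellsFrom (suc i) rs

cells : List ℕ → List Cell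
cells = cellsFrom 1

skewCells : List ℕ → List ℕ → List Cell
skewCells λ' μ = bfilter (λ c → not (inShape μ c)) (cells λ')

even : ℕ → Bool
even zero          = true
even (suc zero)    = false
even (suc (suc n)) = even n

count : {A : Set} → (A → Bool) → List A → ℕ
count p xs = length (bfilter p xs)

vS hS dS : List ℕ → List ℕ → ℕ
vS λ' μ = count (λ c → even (proj₁ c)) (skewCells λ' μ)
hS λ' μ = count (λ c → even (proj₂ c)) (skewCells λ' μ)
dS λ' μ = count (λ c → even (proj₁ c) ∧ even (proj₂ c)) (skewCells λ' μ)

-- Tableaux: a tableau is an association list (cell , entry).

Tab : Set
Tab = List (Cell × ℕ)

insertions : ℕ → List ℕ → List (List ℕ)
insertions x []       = (x ∷ []) ∷ []
insertions x (y ∷ ys) = (x ∷ y ∷ ys) ∷ map (y ∷_) (insertions x ys)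

perms : List ℕ → List (List ℕ)
perms []       = [] ∷ []
perms (x ∷ xs) = concatMap (insertions x) (perms xs)

allPairs : {A : Set} → List A → List (A × A)
allPairs xs = concatMap (λ a → map (a ,_) xs) xs

increasing : Tab → Bool
increasing T = foldr (λ p acc → ok p ∧ acc) true (allPairs T)
  where
  ok : (Cell × ℕ) × (Cell × ℕ) → Bool
  ok (((i , j) , s) , ((i' , j') , t)) =
    not (((i ≡ᵇ i') ∧ (j <ᵇ j')) ∨ ((j ≡ᵇ j') ∧ (i <ᵇ i'))) ∨ (s <ᵇ t)

SYTs : List ℕ → List ℕ → List Tab
SYTs λ' μ = bfilter increasing
  (map (zip cs) (perms (range 1 (length cs))))
  where cs = skewCells λ' μ

negOnePow : ℕ → ℤ
negOnePow zero          = + 1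
negOnePow (suc zero)    = ℤ.- (+ 1)
negOnePow (suc (suc k)) = negOnePow k

inversions : Tab → ℕ
inversions T = count (λ { ((a , s) , (b , t)) → (a ◁ b) ∧ (t <ᵇ s) }) (allPairs T)

signStraight : Tab → ℤ
signStraight T = negOnePow (inversions T)

_⋄_ : Tab → Tab → Tab
T₁ ⋄ T₂ = T₁ ++ map (λ { (c , t) → (c , t + length T₁) }) T₂

T₀ : List ℕ → Tab
T₀ μ = zip (cells μ) (range 1 (size μ))

signSkew : List ℕ → Tab → ℤ
signSkew μ T = signStraight (T₀ μ) ℤ.* signStraight (T₀ μ ⋄ T)

I : List ℕ → List ℕ → ℤ
I λ' μ = foldr (λ T acc → signSkew μ T ℤ.+ acc) (+ 0) (SYTs λ' μ)

-- Polynomials in ℤ[x,y,z] as formal sums of terms c·x^a y^b z^c.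

Exp : Set
Exp = ℕ × ℕ × ℕ

Poly : Set
Poly = List (ℤ × Exp)

coeff : Poly → Exp → ℤ
coeff p (a , b , c) = foldr (λ { (k , (a' , b' , c')) acc →
  (if (a ≡ᵇ a') ∧ (b ≡ᵇ b') ∧ (c ≡ᵇ c') then k else + 0) ℤ.+ acc }) (+ 0) p

_≈P_ : Poly → Poly → Set
p ≈P q = ∀ e → coeff p e ≡ coeff q e

scaleMono : ℤ → Exp → Poly → Poly
scaleMono k (a , b , c) = map (λ { (k' , (a' , b' , c')) → (k ℤ.* k' , (a + a' , b + b' , c + c')) })

F : ℕ → List ℕ → Poly
F n α = map (λ λ' → (I λ' α , (vS λ' α , hS λ' α , dS λ' α))) (shapes α n)

u : List ℕ → List ℕ → ℕ
u ν α = sum (map (λ b → count (b ◁_) (cells α)) (skewCells ν α))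

RHS : ℕ → List ℕ → Poly
RHS n α = concatMap
  (λ ν → scaleMono (negOnePow (u ν α)) (vS ν α , hS ν α , dS ν α) (F n ν))
  (plus α)

module Submission where

-- The recursion of Proposition 4.6 comes from removing the entry 1 from a
-- standard Young tableau of shape λ/α.  The cell b carrying 1 must be a
-- minimal cell of λ/α, i.e. the unique cell of some ν ∈ α⁺ with ν ⊆ λ, and
-- what remains (entries lowered by one) is an SYT of shape λ/ν.  So for
-- α ⊆ λ with λ ≠ α
--     I_{λ/α} = Σ_{ν ∈ α⁺, ν ⊆ λ} (-1)^{u(ν,α)} I_{λ/ν}                  (★)
-- and, since v, h, d are additive over λ/α = ν/α ⊔ λ/ν, comparing
-- coefficients of x^a y^b z^c on both sides gives the proposition.
--
-- The sign
-- of a skew tableau T is rewritten as (-1)^{inv(T) + cross(T,μ)}, where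
-- cross counts pairs (cell of T, cell of μ) in ◁-order ('signedWeight');
-- this form behaves additively when the entry 1 is split off
-- ('weight-put-1', 'weight-addCell').

open import Defs
open import Data.Bool using (Bool; true; false; _∧_; _∨_; not; if_then_else_; T)
open import Data.Bool.Properties using (T-∧; T-∨; ∧-assoc; ∧-comm; ∧-zeroʳ; ∧-identityʳ; ∨-zeroʳ; ∨-identityʳ)
open import Data.Nat using (ℕ; zero; suc; pred; _+_; _∸_; _≤_; _<_; z≤n; s≤s; _≡ᵇ_; _<ᵇ_; _⊓_; _≟_; _<?_; _≤?_)
open import Data.Nat.Properties
  using (≡ᵇ⇒≡; ≡⇒≡ᵇ; <ᵇ⇒<; <⇒<ᵇ; ≤-refl; ≤-trans; ≤-antisym; ≤-pred; <⇒≤; <-irrefl; ≤-<-trans;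
         m≤n⇒m<n∨m≡n; n≤1+n; m≤n⇒m≤1+n; ≰⇒>; ≮⇒≥; n∸n≡0; m∸n≤m; m+[n∸m]≡n; m⊓n≤n; m⊓n≤m; ⊓-glb;
         +-comm; +-assoc; +-suc; +-identityʳ; m≤m+n; m≤n+m; +-mono-≤; +-mono-<-≤; +-cancelˡ-≡; +-cancelˡ-<;
         n≤0⇒n≡0; m+n∸m≡n; m+n≡0⇒m≡0; m+n≡0⇒n≡0; <⇒≢; suc-injective; pred-mono-≤)
open import Data.Nat.ListAction using (sum)
open import Data.Integer as ℤ using (ℤ; +_)
import Data.Integer.Properties as ℤP
open import Data.List using (List; []; _∷_; _++_; map; concatMap; concat; foldr; length; zip; head)
import Data.List.Properties as ListP
open import Data.List.Membership.Propositional using (_∈_; _∉_; find; lose)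
open import Data.List.Membership.Propositional.Properties
  using (∈-map⁺; ∈-map⁻; ∈-++⁺ˡ; ∈-++⁺ʳ; ∈-++⁻; ∈-concatMap⁺; ∈-concatMap⁻)
open import Data.List.Membership.Propositional.Properties.WithK using (unique∧set⇒bag)
open import Data.List.Relation.Unary.Any using (here; there)
open import Data.List.Relation.Unary.All as All using (All; []; _∷_)
open import Data.List.Relation.Unary.Linked using (Linked; [-]) renaming ([] to L[]; _∷_ to _L∷_)
open import Data.List.Relation.Unary.AllPairs using ([]; _∷_)
open import Data.List.Relation.Unary.Unique.Propositional using (Unique)
import Data.List.Relation.Unary.Unique.Propositional.Properties as UniqueP
open import Data.List.Relation.Binary.BagAndSetEquality using (∼bag⇒↭)
open import Data.List.Relation.Binary.Permutation.Propositional as Perm using (_↭_)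
import Data.List.Relation.Binary.Permutation.Propositional.Properties as PermP
open import Data.Maybe using (just)
open import Data.Maybe.Properties using (just-injective)
open import Data.Product using (Σ; Σ-syntax; _×_; _,_; proj₁; proj₂)
open import Data.Sum using (_⊎_; inj₁; inj₂; [_,_]′)
open import Data.Unit using (tt)
open import Data.Empty using (⊥; ⊥-elim)
open import Function using (Equivalence; mk⇔)
open import Relation.Nullary using (¬_; yes; no)
open import Relation.Binary.PropositionalEquality
  using (_≡_; _≢_; refl; sym; trans; cong; cong₂; subst; module ≡-Reasoning)
open ≡-Reasoning

module ListSum {C : Set} (_⊕_ : C → C → C) (ε : C)
  (⊕-assoc : ∀ a b c → (a ⊕ b) ⊕ c ≡ a ⊕ (b ⊕ c))
  (⊕-comm : ∀ a b → a ⊕ b ≡ b ⊕ a)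
  (⊕-identityˡ : ∀ a → ε ⊕ a ≡ a) where

  ∑ : {A : Set} → (A → C) → List A → C
  ∑ f []       = ε
  ∑ f (x ∷ xs) = f x ⊕ ∑ f xs

  ⊕-interchange : ∀ a b c d → (a ⊕ b) ⊕ (c ⊕ d) ≡ (a ⊕ c) ⊕ (b ⊕ d)
  ⊕-interchange a b c d = begin
    (a ⊕ b) ⊕ (c ⊕ d)  ≡⟨ ⊕-assoc a b (c ⊕ d) ⟩
    a ⊕ (b ⊕ (c ⊕ d))  ≡⟨ cong (a ⊕_) (sym (⊕-assoc b c d)) ⟩
    a ⊕ ((b ⊕ c) ⊕ d)  ≡⟨ cong (λ t → a ⊕ (t ⊕ d)) (⊕-comm b c) ⟩
    a ⊕ ((c ⊕ b) ⊕ d)  ≡⟨ cong (a ⊕_) (⊕-assoc c b d) ⟩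
    a ⊕ (c ⊕ (b ⊕ d))  ≡⟨ sym (⊕-assoc a c (b ⊕ d)) ⟩
    (a ⊕ c) ⊕ (b ⊕ d)  ∎

  ∑-++ : {A : Set} (f : A → C) (xs ys : List A) → ∑ f (xs ++ ys) ≡ ∑ f xs ⊕ ∑ f ys
  ∑-++ f []       ys = sym (⊕-identityˡ _)
  ∑-++ f (x ∷ xs) ys = trans (cong (f x ⊕_) (∑-++ f xs ys)) (sym (⊕-assoc _ _ _))

  ∑-map : {A B : Set} (f : B → C) (g : A → B) (xs : List A) → ∑ f (map g xs) ≡ ∑ (λ x → f (g x)) xs
  ∑-map f g []       = refl
  ∑-map f g (x ∷ xs) = cong (f (g x) ⊕_) (∑-map f g xs)

  ∑-concatMap : {A B : Set} (f : B → C) (g : A → List B) (xs : List A) →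
    ∑ f (concatMap g xs) ≡ ∑ (λ x → ∑ f (g x)) xs
  ∑-concatMap f g []       = refl
  ∑-concatMap f g (x ∷ xs) =
    trans (∑-++ f (g x) (concat (map g xs))) (cong (∑ f (g x) ⊕_) (∑-concatMap f g xs))

  ∑-cong : {A : Set} {f g : A → C} (xs : List A) → (∀ x → x ∈ xs → f x ≡ g x) → ∑ f xs ≡ ∑ g xs
  ∑-cong []       e = refl
  ∑-cong (x ∷ xs) e = cong₂ _⊕_ (e x (here refl)) (∑-cong xs (λ y p → e y (there p)))

  ∑-ext : {A : Set} {f g : A → C} (xs : List A) → (∀ x → f x ≡ g x) → ∑ f xs ≡ ∑ g xs
  ∑-ext xs e = ∑-cong xs (λ x _ → e x)

  ∑-⊕ : {A : Set} (f g : A → C) (xs : List A) → ∑ (λ x → f x ⊕ g x) xs ≡ ∑ f xs ⊕ ∑ g xs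
  ∑-⊕ f g []       = sym (⊕-identityˡ ε)
  ∑-⊕ f g (x ∷ xs) = trans (cong ((f x ⊕ g x) ⊕_) (∑-⊕ f g xs)) (⊕-interchange _ _ _ _)

  ∑-ε : {A : Set} (xs : List A) → ∑ (λ _ → ε) xs ≡ ε
  ∑-ε []       = refl
  ∑-ε (x ∷ xs) = trans (⊕-identityˡ _) (∑-ε xs)

  ∑-vanish : {A : Set} {f : A → C} (xs : List A) → (∀ x → x ∈ xs → f x ≡ ε) → ∑ f xs ≡ ε
  ∑-vanish xs e = trans (∑-cong xs e) (∑-ε xs)

  ∑-swap : {A B : Set} (h : A → B → C) (xs : List A) (ys : List B) →
    ∑ (λ x → ∑ (h x) ys) xs ≡ ∑ (λ y → ∑ (λ x → h x y) xs) ys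
  ∑-swap h []       ys = sym (∑-ε ys)
  ∑-swap h (x ∷ xs) ys =
    trans (cong (∑ (h x) ys ⊕_) (∑-swap h xs ys)) (sym (∑-⊕ (h x) (λ y → ∑ (λ x → h x y) xs) ys))

  ∑-↭ : {A : Set} (f : A → C) {xs ys : List A} → xs ↭ ys → ∑ f xs ≡ ∑ f ys
  ∑-↭ f Perm.refl           = refl
  ∑-↭ f (Perm.prep x p)     = cong (f x ⊕_) (∑-↭ f p)
  ∑-↭ f (Perm.swap x y p)   =
    trans (sym (⊕-assoc _ _ _)) (trans (cong₂ _⊕_ (⊕-comm (f x) (f y)) (∑-↭ f p)) (⊕-assoc _ _ _))
  ∑-↭ f (Perm.trans p q)    = trans (∑-↭ f p) (∑-↭ f q)

  ∑² : {A : Set} → (A → A → C) → List A → C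
  ∑² h xs = ∑ (λ a → ∑ (h a) xs) xs

  ∑²-ext : {A : Set} {h g : A → A → C} (xs : List A) → (∀ a c → h a c ≡ g a c) → ∑² h xs ≡ ∑² g xs
  ∑²-ext xs e = ∑-ext xs (λ a → ∑-ext xs (e a))

  ∑²-map : {A B : Set} (h : B → B → C) (f : A → B) (xs : List A) →
    ∑² h (map f xs) ≡ ∑² (λ a c → h (f a) (f c)) xs
  ∑²-map h f xs = trans (∑-map (λ a → ∑ (h a) (map f xs)) f xs) (∑-ext xs (λ a → ∑-map (h (f a)) f xs))

  ∑²-↭ : {A : Set} (h : A → A → C) {xs ys : List A} → xs ↭ ys → ∑² h xs ≡ ∑² h ys
  ∑²-↭ h {xs} {ys} p = trans (∑-ext xs (λ a → ∑-↭ (h a) p)) (∑-↭ (λ a → ∑ (h a) ys) p)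

  ∑²-cons : {A : Set} (h : A → A → C) (x : A) (xs : List A) →
    ∑² h (x ∷ xs) ≡ (h x x ⊕ (∑ (h x) xs ⊕ ∑ (λ a → h a x) xs)) ⊕ ∑² h xs
  ∑²-cons h x xs =
    trans (cong ((h x x ⊕ ∑ (h x) xs) ⊕_) (∑-⊕ (λ a → h a x) (λ a → ∑ (h a) xs) xs))
    (trans (⊕-assoc _ _ _) (trans (cong (h x x ⊕_) (sym (⊕-assoc _ _ _))) (sym (⊕-assoc _ _ _))))

  ∑²-++ : {A : Set} (h : A → A → C) (xs ys : List A) →
    ∑² h (xs ++ ys) ≡ (∑² h xs ⊕ ∑ (λ a → ∑ (h a) ys) xs) ⊕ (∑ (λ b → ∑ (h b) xs) ys ⊕ ∑² h ys)
  ∑²-++ h xs ys = trans (∑-++ (λ a → ∑ (h a) (xs ++ ys)) xs ys) (cong₂ _⊕_ (split xs) (split ys))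
    where
    split : ∀ zs → ∑ (λ a → ∑ (h a) (xs ++ ys)) zs ≡ ∑ (λ a → ∑ (h a) xs) zs ⊕ ∑ (λ a → ∑ (h a) ys) zs
    split zs = trans (∑-ext zs (λ a → ∑-++ (h a) xs ys)) (∑-⊕ (λ a → ∑ (h a) xs) (λ a → ∑ (h a) ys) zs)

  ∑-allPairs : {A : Set} (g : A × A → C) (xs : List A) → ∑ g (allPairs xs) ≡ ∑² (λ a c → g (a , c)) xs
  ∑-allPairs g xs = trans (∑-concatMap g (λ a → map (a ,_) xs) xs) (∑-ext xs (λ a → ∑-map g (a ,_) xs))

  when : Bool → C → C
  when b c = if b then c else ε

  ∑-bfilter : {A : Set} (f : A → C) (p : A → Bool) (xs : List A) →
    ∑ f (bfilter p xs) ≡ ∑ (λ x → when (p x) (f x)) xs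
  ∑-bfilter f p []       = refl
  ∑-bfilter f p (x ∷ xs) with p x
  ... | true  = cong (f x ⊕_) (∑-bfilter f p xs)
  ... | false = trans (∑-bfilter f p xs) (sym (⊕-identityˡ _))

  ∑-when : {A : Set} (b : Bool) (f : A → C) (xs : List A) → ∑ (λ x → when b (f x)) xs ≡ when b (∑ f xs)
  ∑-when true  f xs = refl
  ∑-when false f xs = ∑-ε xs

module ℕΣ = ListSum _+_ 0 +-assoc +-comm (λ a → refl)
module ℤΣ = ListSum ℤ._+_ (+ 0) ℤP.+-assoc ℤP.+-comm ℤP.+-identityˡ
module BoolΣ = ListSum _∧_ true ∧-assoc ∧-comm (λ a → refl)

δ : Bool → ℕ
δ b = if b then 1 else 0

count-∑ : {A : Set} (p : A → Bool) (xs : List A) → count p xs ≡ ℕΣ.∑ (λ x → δ (p x)) xs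
count-∑ p []       = refl
count-∑ p (x ∷ xs) with p x
... | true  = cong suc (count-∑ p xs)
... | false = count-∑ p xs

foldr-ℤ : {X : Set} (f : X → ℤ) (xs : List X) → foldr (λ t acc → f t ℤ.+ acc) (+ 0) xs ≡ ℤΣ.∑ f xs
foldr-ℤ f []       = refl
foldr-ℤ f (x ∷ xs) = cong (λ z → f x ℤ.+ z) (foldr-ℤ f xs)

foldr-∧ : {X : Set} (g : X → Bool) (xs : List X) → foldr (λ p acc → g p ∧ acc) true xs ≡ BoolΣ.∑ g xs
foldr-∧ g []       = refl
foldr-∧ g (x ∷ xs) = cong (g x ∧_) (foldr-∧ g xs)

BoolΣ-all⁻ : {X : Set} {g : X → Bool} (xs : List X) → T (BoolΣ.∑ g xs) → ∀ x → x ∈ xs → T (g x)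
BoolΣ-all⁻ (y ∷ xs) p x (here refl) = proj₁ (Equivalence.to T-∧ p)
BoolΣ-all⁻ (y ∷ xs) p x (there q)   = BoolΣ-all⁻ xs (proj₂ (Equivalence.to T-∧ p)) x q

BoolΣ-all⁺ : {X : Set} {g : X → Bool} (xs : List X) → (∀ x → x ∈ xs → T (g x)) → T (BoolΣ.∑ g xs)
BoolΣ-all⁺ []       h = tt
BoolΣ-all⁺ (y ∷ xs) h = Equivalence.from T-∧ (h y (here refl) , BoolΣ-all⁺ xs (λ x q → h x (there q)))

ℤ*-∑ : {A : Set} (k : ℤ) (f : A → ℤ) (xs : List A) → ℤΣ.∑ (λ x → k ℤ.* f x) xs ≡ k ℤ.* ℤΣ.∑ f xs
ℤ*-∑ k f []       = sym (ℤP.*-zeroʳ k)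
ℤ*-∑ k f (x ∷ xs) = trans (cong (λ z → k ℤ.* f x ℤ.+ z) (ℤ*-∑ k f xs)) (sym (ℤP.*-distribˡ-+ k (f x) (ℤΣ.∑ f xs)))

ℤ*-when : ∀ b k z → ℤΣ.when b (k ℤ.* z) ≡ k ℤ.* ℤΣ.when b z
ℤ*-when true  k z = refl
ℤ*-when false k z = sym (ℤP.*-zeroʳ k)

when-∧ : ∀ m i k z → ℤΣ.when (m ∧ i) (k ℤ.* z) ≡ ℤΣ.when m (k ℤ.* ℤΣ.when i z)
when-∧ true  true  k z = refl
when-∧ true  false k z = sym (ℤP.*-zeroʳ k)
when-∧ false i     k z = refl

when-false : ∀ {b} (z : ℤ) → ¬ T b → ℤΣ.when b z ≡ + 0
when-false {false} z _ = refl
when-false {true}  z n = ⊥-elim (n tt)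

when-zero : ∀ b → ℤΣ.when b (+ 0) ≡ + 0
when-zero true  = refl
when-zero false = refl

T-∧⁺ : ∀ {x y} → T x → T y → T (x ∧ y)
T-∧⁺ p q = Equivalence.from T-∧ (p , q)

T-∧₁ : ∀ {x y} → T (x ∧ y) → T x
T-∧₁ {true} _ = tt

T-∧₂ : ∀ {x y} → T (x ∧ y) → T y
T-∧₂ {true} p = p

T-∨₁ : ∀ {x y} → T x → T (x ∨ y)
T-∨₁ p = Equivalence.from T-∨ (inj₁ p)

T-∨₂ : ∀ {x y} → T y → T (x ∨ y)
T-∨₂ {x} p = Equivalence.from (T-∨ {x}) (inj₂ p)

T-not⁺ : ∀ {x} → ¬ T x → T (not x)
T-not⁺ {false} _ = tt
T-not⁺ {true}  n = n tt

T-not⁻ : ∀ {x} → T (not x) → ¬ T x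
T-not⁻ {false} _ ()

T-≡true : ∀ {x} → T x → x ≡ true
T-≡true {true} _ = refl

T-ext : ∀ {x y} → (T x → T y) → (T y → T x) → x ≡ y
T-ext {false} {false} _ _ = refl
T-ext {false} {true}  _ g = ⊥-elim (g tt)
T-ext {true}  {false} f _ = ⊥-elim (f tt)
T-ext {true}  {true}  _ _ = refl

≤ᵇ⇒≤ : ∀ a b → T (a ≤ᵇ b) → a ≤ b
≤ᵇ⇒≤ zero    b       _ = z≤n
≤ᵇ⇒≤ (suc a) (suc b) p = s≤s (≤ᵇ⇒≤ a b p)

≤⇒≤ᵇ : ∀ a b → a ≤ b → T (a ≤ᵇ b)
≤⇒≤ᵇ zero    zero    _       = tt
≤⇒≤ᵇ zero    (suc b) _       = tt
≤⇒≤ᵇ (suc a) (suc b) (s≤s p) = ≤⇒≤ᵇ a b p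

n<ᵇn : ∀ n → (n <ᵇ n) ≡ false
n<ᵇn zero    = refl
n<ᵇn (suc n) = n<ᵇn n

<ᵇ-+ʳ : ∀ a b k → (a + k <ᵇ b + k) ≡ (a <ᵇ b)
<ᵇ-+ʳ a b k rewrite +-comm a k | +-comm b k = go k
  where
  go : ∀ k → (k + a <ᵇ k + b) ≡ (a <ᵇ b)
  go zero    = refl
  go (suc k) = go k

unique-∷ : {A : Set} {x : A} {xs : List A} → x ∉ xs → Unique xs → Unique (x ∷ xs)
unique-∷ {xs = xs} x∉ u = All.tabulate (λ y∈ x≡y → x∉ (subst (_∈ xs) (sym x≡y) y∈)) ∷ u

unique-head : {A : Set} {x : A} {xs : List A} → Unique (x ∷ xs) → x ∉ xs
unique-head (h ∷ _) p = All.lookup h p refl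

unique-tail : {A : Set} {x : A} {xs : List A} → Unique (x ∷ xs) → Unique xs
unique-tail (_ ∷ u) = u

unique-↭ : {A : Set} {xs ys : List A} → Unique xs → Unique ys →
  (∀ x → x ∈ xs → x ∈ ys) → (∀ x → x ∈ ys → x ∈ xs) → xs ↭ ys
unique-↭ ux uy f g = ∼bag⇒↭ (unique∧set⇒bag ux uy (mk⇔ (f _) (g _)))

∈-bfilter⁻ : {A : Set} (p : A → Bool) (xs : List A) {x : A} → x ∈ bfilter p xs → x ∈ xs × T (p x)
∈-bfilter⁻ p (y ∷ xs) q with p y in eq
∈-bfilter⁻ p (y ∷ xs) (here refl) | true  = here refl , subst T (sym eq) tt
∈-bfilter⁻ p (y ∷ xs) (there q)   | true  = let (a , b) = ∈-bfilter⁻ p xs q in there a , b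
∈-bfilter⁻ p (y ∷ xs) q           | false = let (a , b) = ∈-bfilter⁻ p xs q in there a , b

∈-bfilter⁺ : {A : Set} (p : A → Bool) (xs : List A) {x : A} → x ∈ xs → T (p x) → x ∈ bfilter p xs
∈-bfilter⁺ p (y ∷ xs) q t with p y in eq
∈-bfilter⁺ p (y ∷ xs) (here refl) t | true  = here refl
∈-bfilter⁺ p (y ∷ xs) (there q)   t | true  = there (∈-bfilter⁺ p xs q t)
∈-bfilter⁺ p (y ∷ xs) (here refl) t | false = ⊥-elim (subst T eq t)
∈-bfilter⁺ p (y ∷ xs) (there q)   t | false = ∈-bfilter⁺ p xs q t

unique-bfilter : {A : Set} (p : A → Bool) {xs : List A} → Unique xs → Unique (bfilter p xs)
unique-bfilter p {[]}     u = []
unique-bfilter p {y ∷ xs} u with p y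
... | true  = unique-∷ (λ q → unique-head u (proj₁ (∈-bfilter⁻ p xs q))) (unique-bfilter p (unique-tail u))
... | false = unique-bfilter p (unique-tail u)

bfilter-∘ : {A : Set} (p q : A → Bool) (xs : List A) → bfilter p (bfilter q xs) ≡ bfilter (λ x → q x ∧ p x) xs
bfilter-∘ p q []       = refl
bfilter-∘ p q (x ∷ xs) with q x
... | false = bfilter-∘ p q xs
... | true with p x
...   | true  = cong (x ∷_) (bfilter-∘ p q xs)
...   | false = bfilter-∘ p q xs

bfilter-ext : {A : Set} (p q : A → Bool) (xs : List A) → (∀ x → p x ≡ q x) → bfilter p xs ≡ bfilter q xs
bfilter-ext p q []       e = refl
bfilter-ext p q (x ∷ xs) e rewrite e x with q x
... | true  = cong (x ∷_) (bfilter-ext p q xs e)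
... | false = bfilter-ext p q xs e

∈-concatMap⁻′ : {A B : Set} (g : A → List B) (xs : List A) {y : B} →
  y ∈ concatMap g xs → Σ[ x ∈ A ] x ∈ xs × y ∈ g x
∈-concatMap⁻′ g xs p = find (∈-concatMap⁻ g p)

unique-concatMap : {A B : Set} (g : A → List B) (xs : List A) → Unique xs →
  (∀ x → x ∈ xs → Unique (g x)) → (∀ x x' y → y ∈ g x → y ∈ g x' → x ≡ x') → Unique (concatMap g xs)
unique-concatMap g []       u ug dj = []
unique-concatMap g (x ∷ xs) u ug dj =
  UniqueP.++⁺ (ug x (here refl)) (unique-concatMap g xs (unique-tail u) (λ x' p → ug x' (there p)) dj)
    λ (p , q) → let (x' , a , b) = ∈-concatMap⁻′ g xs q in unique-head u (subst (_∈ xs) (sym (dj x x' _ p b)) a)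

unique-map : {A B : Set} (f : A → B) (xs : List A) → Unique xs →
  (∀ x y → x ∈ xs → y ∈ xs → f x ≡ f y → x ≡ y) → Unique (map f xs)
unique-map f []       u inj = []
unique-map f (x ∷ xs) u inj = unique-∷
  (λ p → let (y , a , b) = ∈-map⁻ f p in unique-head u (subst (_∈ xs) (sym (inj x y (here refl) (there a) b)) a))
  (unique-map f xs (unique-tail u) (λ a b p q → inj a b (there p) (there q)))

range-∈⁻ : ∀ a n {j} → j ∈ range a n → a ≤ j × j < a + n
range-∈⁻ a (suc n) (here refl) = ≤-refl , subst (a <_) (sym (+-suc a n)) (s≤s (m≤m+n a n))
range-∈⁻ a (suc n) {j} (there p) =
  let (lo , hi) = range-∈⁻ (suc a) n p in <⇒≤ lo , subst (j <_) (sym (+-suc a n)) hi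

range-∈⁺ : ∀ a n {j} → a ≤ j → j < a + n → j ∈ range a n
range-∈⁺ a zero    {j} p q = ⊥-elim (<-irrefl refl (≤-trans q (subst (_≤ j) (sym (+-identityʳ a)) p)))
range-∈⁺ a (suc n) {j} p q with m≤n⇒m<n∨m≡n p
... | inj₂ refl = here refl
... | inj₁ a<j  = there (range-∈⁺ (suc a) n a<j (subst (j <_) (+-suc a n) q))

unique-range : ∀ a n → Unique (range a n)
unique-range a zero    = []
unique-range a (suc n) = unique-∷ (λ p → <-irrefl refl (proj₁ (range-∈⁻ (suc a) n p))) (unique-range (suc a) n)

length-range : ∀ a n → length (range a n) ≡ n
length-range a zero    = refl
length-range a (suc n) = cong suc (length-range (suc a) n)

range-suc : ∀ a n → range (suc a) n ≡ map suc (range a n)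
range-suc a zero    = refl
range-suc a (suc n) = cong (suc a ∷_) (range-suc (suc a) n)

map-proj₁-zip : {A B : Set} (xs : List A) (ys : List B) → length xs ≡ length ys → map proj₁ (zip xs ys) ≡ xs
map-proj₁-zip []       ys       e = refl
map-proj₁-zip (x ∷ xs) (y ∷ ys) e = cong (x ∷_) (map-proj₁-zip xs ys (suc-injective e))

length-zip : {A B : Set} (xs : List A) (ys : List B) → length xs ≡ length ys → length (zip xs ys) ≡ length xs
length-zip []       ys       e = refl
length-zip (x ∷ xs) (y ∷ ys) e = cong suc (length-zip xs ys (suc-injective e))

All-zip₂ : {A B : Set} {P : B → Set} (xs : List A) (ys : List B) → All P ys → All (λ x → P (proj₂ x)) (zip xs ys)
All-zip₂ []       ys       a        = []
All-zip₂ (x ∷ xs) []       a        = []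
All-zip₂ (x ∷ xs) (y ∷ ys) (p ∷ a) = p ∷ All-zip₂ xs ys a

-- Shapes.  We index rows from 0 in proofs: 'row μ i' is the length of row
-- i+1 of μ, and 'InShape μ c' is the propositional form of 'inShape'.

row : List ℕ → ℕ → ℕ
row []       _       = 0
row (r ∷ rs) zero    = r
row (r ∷ rs) (suc i) = row rs i

rowLen-row : ∀ μ i → rowLen μ (suc i) ≡ row μ i
rowLen-row []       i       = refl
rowLen-row (r ∷ rs) zero    = refl
rowLen-row (r ∷ rs) (suc i) = rowLen-row rs i

InShape : List ℕ → Cell → Set
InShape μ (zero  , j) = ⊥
InShape μ (suc i , j) = 1 ≤ j × j ≤ row μ i

inShape⁻ : ∀ μ c → T (inShape μ c) → InShape μ c
inShape⁻ μ (zero  , j) ()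
inShape⁻ μ (suc i , j) p =
  ≤ᵇ⇒≤ 1 j (T-∧₁ (T-∧₂ {1 ≤ᵇ suc i} p)) ,
  subst (j ≤_) (rowLen-row μ i) (≤ᵇ⇒≤ j _ (T-∧₂ {1 ≤ᵇ j} (T-∧₂ {1 ≤ᵇ suc i} p)))

inShape⁺ : ∀ μ c → InShape μ c → T (inShape μ c)
inShape⁺ μ (suc i , j) (a , b) =
  T-∧⁺ (≤⇒≤ᵇ 1 (suc i) (s≤s z≤n)) (T-∧⁺ (≤⇒≤ᵇ 1 j a) (≤⇒≤ᵇ j _ (subst (j ≤_) (sym (rowLen-row μ i)) b)))

_⊆_ : List ℕ → List ℕ → Set
μ ⊆ ν = ∀ k → row μ k ≤ row ν k

⊆ᵇ⇒⊆ : ∀ μ ν → T (μ ⊆ᵇ ν) → μ ⊆ ν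
⊆ᵇ⇒⊆ []       ν        p k       = z≤n
⊆ᵇ⇒⊆ (a ∷ as) []       p zero    = subst (_≤ 0) (sym (≡ᵇ⇒≡ a 0 (T-∧₁ p))) z≤n
⊆ᵇ⇒⊆ (a ∷ as) []       p (suc k) = ⊆ᵇ⇒⊆ as [] (T-∧₂ {a ≡ᵇ 0} p) k
⊆ᵇ⇒⊆ (a ∷ as) (b ∷ bs) p zero    = ≤ᵇ⇒≤ a b (T-∧₁ p)
⊆ᵇ⇒⊆ (a ∷ as) (b ∷ bs) p (suc k) = ⊆ᵇ⇒⊆ as bs (T-∧₂ {a ≤ᵇ b} p) k

⊆⇒⊆ᵇ : ∀ μ ν → μ ⊆ ν → T (μ ⊆ᵇ ν)
⊆⇒⊆ᵇ []       ν        s = tt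
⊆⇒⊆ᵇ (a ∷ as) []       s = T-∧⁺ (≡⇒≡ᵇ a 0 (n≤0⇒n≡0 (s 0))) (⊆⇒⊆ᵇ as [] (λ k → s (suc k)))
⊆⇒⊆ᵇ (a ∷ as) (b ∷ bs) s = T-∧⁺ {a ≤ᵇ b} (≤⇒≤ᵇ a b (s 0)) (⊆⇒⊆ᵇ as bs (λ k → s (suc k)))

⊆-trans : ∀ {μ ν λ'} → μ ⊆ ν → ν ⊆ λ' → μ ⊆ λ'
⊆-trans s t k = ≤-trans (s k) (t k)

InShape-mono : ∀ μ ν → μ ⊆ ν → ∀ c → InShape μ c → InShape ν c
InShape-mono μ ν s (suc k , j) (a , q) = a , ≤-trans q (s k)

-- Cells of a shape: 'cellsFrom (suc k) rs' lists the cells of rs placed in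
-- rows k+1, k+2, …; so 'cells μ' lists exactly the cells of μ, once each.

InRowsFrom : ℕ → List ℕ → Cell → Set
InRowsFrom k rs (zero  , j) = ⊥
InRowsFrom k rs (suc i , j) = k ≤ i × 1 ≤ j × j ≤ row rs (i ∸ k)

∸-suc : ∀ k i → suc k ≤ i → i ∸ k ≡ suc (i ∸ suc k)
∸-suc zero    (suc i) _       = refl
∸-suc (suc k) (suc i) (s≤s p) = ∸-suc k i p

cellsFrom-∈⁻ : ∀ k rs c → c ∈ cellsFrom (suc k) rs → InRowsFrom k rs c
cellsFrom-∈⁻ k (r ∷ rs) c p with ∈-++⁻ (map (suc k ,_) (range 1 r)) p
... | inj₁ q with ∈-map⁻ (suc k ,_) q
...   | j , j∈ , refl = ≤-refl , proj₁ (range-∈⁻ 1 r j∈) ,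
          subst (λ z → j ≤ row (r ∷ rs) z) (sym (n∸n≡0 k)) (≤-pred (proj₂ (range-∈⁻ 1 r j∈)))
cellsFrom-∈⁻ k (r ∷ rs) (suc i , j) p | inj₂ q with cellsFrom-∈⁻ (suc k) rs (suc i , j) q
... | k<i , b , c = <⇒≤ k<i , b , subst (λ z → j ≤ row (r ∷ rs) z) (sym (∸-suc k i k<i)) c
cellsFrom-∈⁻ k (r ∷ rs) (zero , j) p | inj₂ q = cellsFrom-∈⁻ (suc k) rs (zero , j) q

cellsFrom-∈⁺ : ∀ k rs c → InRowsFrom k rs c → c ∈ cellsFrom (suc k) rs
cellsFrom-∈⁺ k [] (suc i , j) (a , b , c) with ≤-antisym c z≤n
cellsFrom-∈⁺ k [] (suc i , .0) (a , () , c) | refl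
cellsFrom-∈⁺ k (r ∷ rs) (suc i , j) (a , b , c) with m≤n⇒m<n∨m≡n a
... | inj₂ refl = ∈-++⁺ˡ (∈-map⁺ (suc k ,_)
        (range-∈⁺ 1 r b (s≤s (subst (λ z → j ≤ row (r ∷ rs) z) (n∸n≡0 k) c))))
... | inj₁ k<i  = ∈-++⁺ʳ (map (suc k ,_) (range 1 r))
        (cellsFrom-∈⁺ (suc k) rs (suc i , j) (k<i , b , subst (λ z → j ≤ row (r ∷ rs) z) (∸-suc k i k<i) c))

cells-∈⁻ : ∀ μ c → c ∈ cells μ → InShape μ c
cells-∈⁻ μ c p with cellsFrom-∈⁻ 0 μ c p
cells-∈⁻ μ (suc i , j) p | _ , b , c = b , c

cells-∈⁺ : ∀ μ c → InShape μ c → c ∈ cells μ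
cells-∈⁺ μ (suc i , j) (b , c) = cellsFrom-∈⁺ 0 μ (suc i , j) (z≤n , b , c)

unique-cellsFrom : ∀ k rs → Unique (cellsFrom (suc k) rs)
unique-cellsFrom k []       = []
unique-cellsFrom k (r ∷ rs) =
  UniqueP.++⁺ (UniqueP.map⁺ (λ { refl → refl }) (unique-range 1 r)) (unique-cellsFrom (suc k) rs) disjoint
  where
  disjoint : ∀ {v} → ¬ (v ∈ map (suc k ,_) (range 1 r) × v ∈ cellsFrom (suc (suc k)) rs)
  disjoint (p , q) with ∈-map⁻ (suc k ,_) p
  ... | j , _ , refl = <-irrefl refl (proj₁ (cellsFrom-∈⁻ (suc k) rs _ q))

unique-cells : ∀ μ → Unique (cells μ)
unique-cells μ = unique-cellsFrom 0 μ

length-cellsFrom : ∀ i rs → length (cellsFrom i rs) ≡ sum rs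
length-cellsFrom i []       = refl
length-cellsFrom i (r ∷ rs) = trans (ListP.length-++ (map (i ,_) (range 1 r)))
  (cong₂ _+_ (trans (ListP.length-map (i ,_) (range 1 r)) (length-range 1 r)) (length-cellsFrom (suc i) rs))

skew-∈⁻ : ∀ λ' μ c → c ∈ skewCells λ' μ → InShape λ' c × ¬ InShape μ c
skew-∈⁻ λ' μ c p with ∈-bfilter⁻ (λ c → not (inShape μ c)) (cells λ') p
... | c∈ , out = cells-∈⁻ λ' c c∈ , λ q → T-not⁻ out (inShape⁺ μ c q)

skew-∈⁺ : ∀ λ' μ c → InShape λ' c → ¬ InShape μ c → c ∈ skewCells λ' μ
skew-∈⁺ λ' μ c a b =
  ∈-bfilter⁺ (λ c → not (inShape μ c)) (cells λ') (cells-∈⁺ λ' c a) (T-not⁺ (λ q → b (inShape⁻ μ c q)))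

unique-skew : ∀ λ' μ → Unique (skewCells λ' μ)
unique-skew λ' μ = unique-bfilter _ (unique-cells λ')

InShape? : ∀ ν c → InShape ν c ⊎ ¬ InShape ν c
InShape? ν (zero  , j) = inj₂ (λ ())
InShape? ν (suc k , j) with 1 ≤? j | j ≤? row ν k
... | yes a | yes b = inj₁ (a , b)
... | no a  | _     = inj₂ (λ q → a (proj₁ q))
... | _     | no b  = inj₂ (λ q → b (proj₂ q))

skew-split : ∀ α ν λ' → α ⊆ ν → ν ⊆ λ' → skewCells λ' α ↭ skewCells ν α ++ skewCells λ' ν
skew-split α ν λ' α⊆ν ν⊆λ = unique-↭ (unique-skew λ' α)
  (UniqueP.++⁺ (unique-skew ν α) (unique-skew λ' ν)
     (λ (p , q) → proj₂ (skew-∈⁻ λ' ν _ q) (proj₁ (skew-∈⁻ ν α _ p))))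
  to from
  where
  to : ∀ c → c ∈ skewCells λ' α → c ∈ skewCells ν α ++ skewCells λ' ν
  to c p with skew-∈⁻ λ' α c p | InShape? ν c
  ... | inλ , ∉α | inj₁ inν = ∈-++⁺ˡ (skew-∈⁺ ν α c inν ∉α)
  ... | inλ , ∉α | inj₂ ∉ν  = ∈-++⁺ʳ (skewCells ν α) (skew-∈⁺ λ' ν c inλ ∉ν)
  from : ∀ c → c ∈ skewCells ν α ++ skewCells λ' ν → c ∈ skewCells λ' α
  from c p with ∈-++⁻ (skewCells ν α) p
  ... | inj₁ q = let (a , b) = skew-∈⁻ ν α c q in skew-∈⁺ λ' α c (InShape-mono ν λ' ν⊆λ c a) b
  ... | inj₂ q = let (a , b) = skew-∈⁻ λ' ν c q in skew-∈⁺ λ' α c a (λ x → b (InShape-mono α ν α⊆ν c x))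

count-skew-split : ∀ α ν λ' → α ⊆ ν → ν ⊆ λ' → ∀ p →
  count p (skewCells ν α) + count p (skewCells λ' ν) ≡ count p (skewCells λ' α)
count-skew-split α ν λ' α⊆ν ν⊆λ p = begin
  count p (skewCells ν α) + count p (skewCells λ' ν)
    ≡⟨ cong₂ _+_ (count-∑ p (skewCells ν α)) (count-∑ p (skewCells λ' ν)) ⟩
  ∑δ (skewCells ν α) + ∑δ (skewCells λ' ν)
    ≡⟨ sym (ℕΣ.∑-++ (λ x → δ (p x)) (skewCells ν α) (skewCells λ' ν)) ⟩
  ∑δ (skewCells ν α ++ skewCells λ' ν)
    ≡⟨ sym (ℕΣ.∑-↭ (λ x → δ (p x)) (skew-split α ν λ' α⊆ν ν⊆λ)) ⟩
  ∑δ (skewCells λ' α)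
    ≡⟨ sym (count-∑ p (skewCells λ' α)) ⟩
  count p (skewCells λ' α) ∎
  where
  ∑δ : List Cell → ℕ
  ∑δ = ℕΣ.∑ (λ x → δ (p x))

Decreasing : List ℕ → Set
Decreasing = Linked (λ a b → b ≤ a)

Positive : List ℕ → Set
Positive = All (λ a → 0 < a)

Decreasing-tail : ∀ {a as} → Decreasing (a ∷ as) → Decreasing as
Decreasing-tail [-]      = L[]
Decreasing-tail (_ L∷ g) = g

Decreasing-∷ : ∀ {a as} → Decreasing as → row as 0 ≤ a → Decreasing (a ∷ as)
Decreasing-∷ {as = []}     _ _ = [-]
Decreasing-∷ {as = b ∷ bs} g p = p L∷ g

head-≥ : ∀ {a as} → Decreasing (a ∷ as) → row as 0 ≤ a
head-≥ {as = []}     _        = z≤n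
head-≥ {as = b ∷ bs} (p L∷ _) = p

all-≤-head : ∀ {a as} → Decreasing (a ∷ as) → All (_≤ a) as
all-≤-head {as = []}     _        = []
all-≤-head {as = b ∷ bs} (p L∷ g) = p ∷ All.map (λ q → ≤-trans q p) (all-≤-head g)

row-step : ∀ α → Decreasing α → ∀ k → row α (suc k) ≤ row α k
row-step []           _        k       = z≤n
row-step (a ∷ as)     g        zero    = head-≥ g
row-step (a ∷ [])     g        (suc k) = z≤n
row-step (a ∷ b ∷ bs) (_ L∷ g) (suc k) = row-step (b ∷ bs) g k

row-mono : ∀ α → Decreasing α → ∀ {k k'} → k ≤ k' → row α k' ≤ row α k
row-mono α g {k} {k'} le with m≤n⇒m<n∨m≡n le
... | inj₂ refl = ≤-refl
row-mono α g {k} {suc k'} le | inj₁ (s≤s lt) = ≤-trans (row-step α g k') (row-mono α g lt)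

row-length : ∀ α k → 0 < row α k → k < length α
row-length (a ∷ as) zero    p = s≤s z≤n
row-length (a ∷ as) (suc k) p = s≤s (row-length as k p)

sum-positive : ∀ ν → Positive ν → sum ν ≡ 0 → ν ≡ []
sum-positive []          _ _ = refl
sum-positive (zero  ∷ ν) (() ∷ _) _
sum-positive (suc a ∷ ν) _        ()

all-≤-sum : ∀ ν → All (_≤ sum ν) ν
all-≤-sum []       = []
all-≤-sum (a ∷ as) = m≤m+n a (sum as) ∷ All.map (λ q → ≤-trans q (m≤n+m (sum as) a)) (all-≤-sum as)

⊆-sum : ∀ α ν → α ⊆ ν → sum α ≤ sum ν
⊆-sum []       ν        s = z≤n
⊆-sum (a ∷ as) []       s = +-mono-≤ (s 0) (⊆-sum as [] (λ k → s (suc k)))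
⊆-sum (a ∷ as) (b ∷ bs) s = +-mono-≤ (s 0) (⊆-sum as bs (λ k → s (suc k)))

+-both-≤-≡ : ∀ {a b c d} → a ≤ b → c ≤ d → a + c ≡ b + d → a ≡ b × c ≡ d
+-both-≤-≡ {a} {b} {c} {d} p q e with m≤n⇒m<n∨m≡n p
... | inj₁ lt   = ⊥-elim (<⇒≢ (+-mono-<-≤ lt q) e)
... | inj₂ refl = refl , +-cancelˡ-≡ a c d e

⊆-sum-≡ : ∀ α ν → Positive α → Positive ν → α ⊆ ν → sum α ≡ sum ν → α ≡ ν
⊆-sum-≡ []       ν        _        pν       s e = sym (sum-positive ν pν (sym e))
⊆-sum-≡ (a ∷ as) []       (pa ∷ _) _        s e = ⊥-elim (<-irrefl refl (≤-trans pa (s 0)))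
⊆-sum-≡ (a ∷ as) (b ∷ bs) (_ ∷ pα) (_ ∷ pν) s e =
  let (e₁ , e₂) = +-both-≤-≡ (s 0) (⊆-sum as bs (λ k → s (suc k))) e
  in cong₂ _∷_ e₁ (⊆-sum-≡ as bs pα pν (λ k → s (suc k)) e₂)

BoundedPartition : ℕ → ℕ → List ℕ → Set
BoundedPartition m k ν = Decreasing ν × Positive ν × sum ν ≡ m × All (_≤ k) ν

-- The fuel decreases in the recursion of partsB.
suc∸≤ : ∀ p m → 1 ≤ p → suc m ∸ p ≤ m
suc∸≤ (suc p) m _ = m∸n≤m m p

partsB-∈⁻ : ∀ f m k ν → m ≤ f → ν ∈ partsB f m k → BoundedPartition m k ν
partsB-∈⁻ f zero k .[] le (here refl) = L[] , [] , refl , []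
partsB-∈⁻ (suc f) (suc m) k ν le mem
  with ∈-concatMap⁻′ (λ p → map (p ∷_) (partsB f (suc m ∸ p) p)) (range 1 (suc m ⊓ k)) mem
... | p , p∈ , q with ∈-map⁻ (p ∷_) q
...   | ν' , ν'∈ , refl =
  let (lo , hi) = range-∈⁻ 1 (suc m ⊓ k) p∈
      p≤ = ≤-pred hi
      (g , ps , sm , al) = partsB-∈⁻ f (suc m ∸ p) p ν' (≤-trans (suc∸≤ p m lo) (≤-pred le)) ν'∈
      p≤k = ≤-trans p≤ (m⊓n≤n _ _)
  in Decreasing-∷ g (head≤ al) , lo ∷ ps , trans (cong (λ z → p + z) sm) (m+[n∸m]≡n (≤-trans p≤ (m⊓n≤m _ _))) ,
     p≤k ∷ All.map (λ q → ≤-trans q p≤k) al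
  where
  head≤ : ∀ {p as} → All (_≤ p) as → row as 0 ≤ p
  head≤ []      = z≤n
  head≤ (q ∷ _) = q

partsB-∈⁺ : ∀ f m k ν → m ≤ f → BoundedPartition m k ν → ν ∈ partsB f m k
partsB-∈⁺ f zero k ν le (g , ps , sm , al) rewrite sum-positive ν ps sm = here refl
partsB-∈⁺ zero (suc m) k ν () _
partsB-∈⁺ (suc f) (suc m) k [] le (g , ps , () , al)
partsB-∈⁺ (suc f) (suc m) k (p ∷ ν') le (g , (p>0 ∷ ps) , sm , (p≤k ∷ al)) =
  ∈-concatMap⁺ (λ p → map (p ∷_) (partsB f (suc m ∸ p) p))
    (lose (range-∈⁺ 1 (suc m ⊓ k) p>0 (s≤s (⊓-glb p≤m p≤k)))
      (∈-map⁺ (p ∷_) (partsB-∈⁺ f (suc m ∸ p) p ν' (≤-trans (suc∸≤ p m p>0) (≤-pred le))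
        (Decreasing-tail g , ps , rest , all-≤-head g))))
  where
  p≤m : p ≤ suc m
  p≤m = subst (p ≤_) sm (m≤m+n p (sum ν'))
  rest : sum ν' ≡ suc m ∸ p
  rest = sym (trans (cong (_∸ p) (sym sm)) (m+n∸m≡n p (sum ν')))

unique-partsB : ∀ f m k → Unique (partsB f m k)
unique-partsB f zero k = unique-∷ (λ ()) []
unique-partsB zero (suc m) k = []
unique-partsB (suc f) (suc m) k = unique-concatMap _ (range 1 (suc m ⊓ k)) (unique-range 1 _)
  (λ p _ → UniqueP.map⁺ (λ { refl → refl }) (unique-partsB f (suc m ∸ p) p))
  (λ x x' y p q → just-injective (trans (sym (head-of x p)) (head-of x' q)))
  where
  head-of : ∀ x {y} {l : List (List ℕ)} → y ∈ map (x ∷_) l → head y ≡ just x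
  head-of x p with ∈-map⁻ (x ∷_) p
  ... | _ , _ , refl = refl

-- Adding one cell.  'addCell α i' lengthens row i (0-indexed) by one; this is
-- a partition exactly when i ≤ length α and 'addable α i' (row i is shorter
-- than row i-1).

addCell : List ℕ → ℕ → List ℕ
addCell []       _       = 1 ∷ []
addCell (a ∷ as) zero    = suc a ∷ as
addCell (a ∷ as) (suc i) = a ∷ addCell as i

addable : List ℕ → ℕ → Bool
addable α zero    = true
addable α (suc i) = row α (suc i) <ᵇ row α i

addableRows : List ℕ → List ℕ
addableRows α = bfilter (addable α) (range 0 (suc (length α)))

newCell : List ℕ → ℕ → Cell
newCell α i = (suc i , suc (row α i))

addableRows-∈⁻ : ∀ α {i} → i ∈ addableRows α → i ≤ length α × T (addable α i)
addableRows-∈⁻ α p = let (a , b) = ∈-bfilter⁻ (addable α) _ p in ≤-pred (proj₂ (range-∈⁻ 0 (suc (length α)) a)) , b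

addableRows-∈⁺ : ∀ α {i} → i ≤ length α → T (addable α i) → i ∈ addableRows α
addableRows-∈⁺ α le ok = ∈-bfilter⁺ (addable α) _ (range-∈⁺ 0 (suc (length α)) z≤n (s≤s le)) ok

unique-addableRows : ∀ α → Unique (addableRows α)
unique-addableRows α = unique-bfilter (addable α) (unique-range 0 (suc (length α)))

row-addCell-≡ : ∀ α i → i ≤ length α → row (addCell α i) i ≡ suc (row α i)
row-addCell-≡ []       zero    _       = refl
row-addCell-≡ (a ∷ as) zero    _       = refl
row-addCell-≡ (a ∷ as) (suc i) (s≤s p) = row-addCell-≡ as i p

row-addCell-≢ : ∀ α i k → i ≤ length α → k ≢ i → row (addCell α i) k ≡ row α k
row-addCell-≢ []       zero    zero    _       ne = ⊥-elim (ne refl)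
row-addCell-≢ []       zero    (suc k) _       ne = refl
row-addCell-≢ (a ∷ as) zero    zero    _       ne = ⊥-elim (ne refl)
row-addCell-≢ (a ∷ as) zero    (suc k) _       ne = refl
row-addCell-≢ (a ∷ as) (suc i) zero    _       ne = refl
row-addCell-≢ (a ∷ as) (suc i) (suc k) (s≤s p) ne = row-addCell-≢ as i k p (λ e → ne (cong suc e))

sum-addCell : ∀ α i → i ≤ length α → sum (addCell α i) ≡ suc (sum α)
sum-addCell []       zero    _       = refl
sum-addCell (a ∷ as) zero    _       = refl
sum-addCell (a ∷ as) (suc i) (s≤s p) = trans (cong (λ z → a + z) (sum-addCell as i p)) (+-suc a (sum as))

⊆-addCell : ∀ α i → i ≤ length α → α ⊆ addCell α i
⊆-addCell α i le k with k ≟ i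
... | yes refl = subst (row α k ≤_) (sym (row-addCell-≡ α k le)) (n≤1+n _)
... | no ne    = subst (row α k ≤_) (sym (row-addCell-≢ α i k le ne)) ≤-refl

addCell-⊆ : ∀ α λ' i → i ≤ length α → α ⊆ λ' → suc (row α i) ≤ row λ' i → addCell α i ⊆ λ'
addCell-⊆ α λ' i le α⊆λ room k with k ≟ i
... | yes refl = subst (_≤ row λ' k) (sym (row-addCell-≡ α k le)) room
... | no k≢i   = subst (_≤ row λ' k) (sym (row-addCell-≢ α i k le k≢i)) (α⊆λ k)

addCell-injective : ∀ α i j → i ≤ length α → j ≤ length α → addCell α i ≡ addCell α j → i ≡ j
addCell-injective []       zero    zero    _       _       _ = refl
addCell-injective (a ∷ as) zero    zero    _       _       _ = refl
addCell-injective (a ∷ as) zero    (suc j) _       _       e = ⊥-elim (<-irrefl (cong suc (sym (ListP.∷-injectiveˡ e))) ≤-refl)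
addCell-injective (a ∷ as) (suc i) zero    _       _       e = ⊥-elim (<-irrefl (cong suc (ListP.∷-injectiveˡ e)) ≤-refl)
addCell-injective (a ∷ as) (suc i) (suc j) (s≤s p) (s≤s q) e = cong suc (addCell-injective as i j p q (ListP.∷-injectiveʳ e))

addable-tail : ∀ a as i → T (addable (a ∷ as) (suc i)) → T (addable as i)
addable-tail a as zero    _ = tt
addable-tail a as (suc i) p = p

addCell-partition : ∀ α i → Decreasing α → Positive α → i ≤ length α → T (addable α i) →
  Decreasing (addCell α i) × Positive (addCell α i)
addCell-partition []       zero    _ _ _ _ = [-] , (s≤s z≤n ∷ [])
addCell-partition (a ∷ as) zero    g ps _ _ =
  Decreasing-∷ (Decreasing-tail g) (m≤n⇒m≤1+n (head-≥ g)) , s≤s z≤n ∷ All.tail ps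
addCell-partition (a ∷ as) (suc i) g (pa ∷ ps) (s≤s le) ok =
  let (g' , ps') = addCell-partition as i (Decreasing-tail g) ps le (addable-tail a as i ok)
  in Decreasing-∷ g' (head-fits i le ok) , pa ∷ ps'
  where
  head-fits : ∀ i → i ≤ length as → T (addable (a ∷ as) (suc i)) → row (addCell as i) 0 ≤ a
  head-fits zero     le ok = subst (_≤ a) (sym (row-addCell-≡ as 0 z≤n)) (<ᵇ⇒< _ _ ok)
  head-fits (suc i') le ok = subst (_≤ a) (sym (row-addCell-≢ as (suc i') 0 le (λ ()))) (head-≥ g)

one-more⇒addCell : ∀ α ν → Decreasing α → Positive α → Decreasing ν → Positive ν →
  sum ν ≡ suc (sum α) → α ⊆ ν → Σ ℕ λ i → i ≤ length α × T (addable α i) × ν ≡ addCell α i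
one-more⇒addCell [] [] _ _ _ _ () _
one-more⇒addCell [] (zero ∷ bs) _ _ _ (() ∷ _) _ _
one-more⇒addCell [] (suc b ∷ bs) _ _ gν (_ ∷ pν) e s
  with m+n≡0⇒m≡0 b (suc-injective e) | sum-positive bs pν (m+n≡0⇒n≡0 b (suc-injective e))
... | refl | refl = 0 , z≤n , tt , refl
one-more⇒addCell (a ∷ as) [] _ _ _ _ () _
one-more⇒addCell (a ∷ as) (b ∷ bs) gα (pa ∷ pα) gν (pb ∷ pν) e s with m≤n⇒m<n∨m≡n (s 0)
... | inj₁ a<b =
  let (e₁ , e₂) = +-both-≤-≡ {suc a} {b} a<b (⊆-sum as bs (λ k → s (suc k))) (sym e)
  in 0 , z≤n , tt , cong₂ _∷_ (sym e₁) (sym (⊆-sum-≡ as bs pα pν (λ k → s (suc k)) e₂))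
... | inj₂ refl =
  let (i , le , ok , eq) = one-more⇒addCell as bs (Decreasing-tail gα) pα (Decreasing-tail gν) pν
                             (+-cancelˡ-≡ a _ _ (trans e (sym (+-suc a (sum as))))) (λ k → s (suc k))
  in suc i , s≤s le , addable-head i ok eq , cong (a ∷_) eq
  where
  addable-head : ∀ i → T (addable as i) → bs ≡ addCell as i → T (addable (a ∷ as) (suc i))
  addable-head zero    _  eq = <⇒<ᵇ (subst (_≤ a) (trans (cong (λ l → row l 0) eq) (row-addCell-≡ as 0 z≤n)) (head-≥ gν))
  addable-head (suc i) ok _  = ok

plus↭addCell : ∀ α → Decreasing α → Positive α → plus α ↭ map (addCell α) (addableRows α)
plus↭addCell α gα pα = unique-↭ (unique-bfilter _ (unique-partsB N N N))
  (unique-map (addCell α) (addableRows α) (unique-addableRows α)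
     (λ x y p q → addCell-injective α x y (proj₁ (addableRows-∈⁻ α p)) (proj₁ (addableRows-∈⁻ α q))))
  to from
  where
  N : ℕ
  N = sum α + 1
  N≡ : N ≡ suc (sum α)
  N≡ = +-comm (sum α) 1
  to : ∀ ν → ν ∈ plus α → ν ∈ map (addCell α) (addableRows α)
  to ν p with ∈-bfilter⁻ (α ⊆ᵇ_) (partitionsOf N) p
  ... | mem , t with partsB-∈⁻ N N N ν ≤-refl mem
  ... | (g , ps , sm , _) with one-more⇒addCell α ν gα pα g ps (trans sm N≡) (⊆ᵇ⇒⊆ α ν t)
  ... | (i , le , ok , eq) = subst (_∈ map (addCell α) (addableRows α)) (sym eq) (∈-map⁺ (addCell α) (addableRows-∈⁺ α le ok))
  from : ∀ ν → ν ∈ map (addCell α) (addableRows α) → ν ∈ plus α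
  from ν p with ∈-map⁻ (addCell α) p
  ... | i , i∈ , refl =
    let (le , ok) = addableRows-∈⁻ α i∈
        (g , ps) = addCell-partition α i gα pα le ok
        size≡ = trans (sum-addCell α i le) (sym N≡)
    in ∈-bfilter⁺ (α ⊆ᵇ_) (partitionsOf N)
         (partsB-∈⁺ N N N (addCell α i) ≤-refl
           (g , ps , size≡ , subst (λ z → All (_≤ z) (addCell α i)) size≡ (all-≤-sum (addCell α i))))
         (⊆⇒⊆ᵇ α (addCell α i) (⊆-addCell α i le))

plus-∈⁻ : ∀ α ν → ν ∈ plus α → α ⊆ ν × sum ν ≡ sum α + 1
plus-∈⁻ α ν p =
  let (mem , t) = ∈-bfilter⁻ (α ⊆ᵇ_) (partitionsOf (sum α + 1)) p
      (_ , _ , sm , _) = partsB-∈⁻ _ _ _ ν ≤-refl mem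
  in ⊆ᵇ⇒⊆ α ν t , sm

remove : Cell → List Cell → List Cell
remove b cs = bfilter (λ c → not (c ==ᶜ b)) cs

==ᶜ⇒≡ : ∀ c b → T (c ==ᶜ b) → c ≡ b
==ᶜ⇒≡ (i , j) (i' , j') p = cong₂ _,_ (≡ᵇ⇒≡ i i' (T-∧₁ p)) (≡ᵇ⇒≡ j j' (T-∧₂ {i ≡ᵇ i'} p))

≡⇒==ᶜ : ∀ c b → c ≡ b → T (c ==ᶜ b)
≡⇒==ᶜ (i , j) .(i , j) refl = T-∧⁺ (≡⇒≡ᵇ i i refl) (≡⇒≡ᵇ j j refl)

remove-∉ : ∀ b cs → b ∉ cs → remove b cs ≡ cs
remove-∉ b []       _  = refl
remove-∉ b (c ∷ cs) b∉ with c ==ᶜ b in eq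
... | true  = ⊥-elim (b∉ (here (sym (==ᶜ⇒≡ c b (subst T (sym eq) tt)))))
... | false = cong (c ∷_) (remove-∉ b cs (λ p → b∉ (there p)))

remove-head : ∀ c cs → remove c (c ∷ cs) ≡ remove c cs
remove-head c cs with c ==ᶜ c in eq
... | true  = refl
... | false = ⊥-elim (subst T eq (≡⇒==ᶜ c c refl))

remove-≢ : ∀ b c cs → c ≢ b → remove b (c ∷ cs) ≡ c ∷ remove b cs
remove-≢ b c cs ne with c ==ᶜ b in eq
... | true  = ⊥-elim (ne (==ᶜ⇒≡ c b (subst T (sym eq) tt)))
... | false = refl

remove-∈⁻ : ∀ b cs {c} → c ∈ remove b cs → c ∈ cs × c ≢ b
remove-∈⁻ b cs p = let (a , t) = ∈-bfilter⁻ _ cs p in a , (λ e → T-not⁻ t (≡⇒==ᶜ _ b e))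

remove-∈⁺ : ∀ b cs {c} → c ∈ cs → c ≢ b → c ∈ remove b cs
remove-∈⁺ b cs {c} p ne = ∈-bfilter⁺ _ cs p (T-not⁺ (λ q → ne (==ᶜ⇒≡ c b q)))

length-remove : ∀ b cs → Unique cs → b ∈ cs → suc (length (remove b cs)) ≡ length cs
length-remove b (.b ∷ cs) u (here refl) =
  cong (λ l → suc (length l)) (trans (remove-head b cs) (remove-∉ b cs (unique-head u)))
length-remove b (c ∷ cs) u (there p) =
  trans (cong (λ l → suc (length l)) (remove-≢ b c cs (λ e → unique-head u (subst (_∈ cs) (sym e) p))))
        (cong suc (length-remove b cs (unique-tail u) p))

module AddedCell (α : List ℕ) (i : ℕ) (le : i ≤ length α) where

  ν : List ℕ
  ν = addCell α i
  b : Cell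
  b = newCell α i

  InShape-ν⁻ : ∀ c → InShape ν c → InShape α c ⊎ c ≡ b
  InShape-ν⁻ (suc k , j) (j≥1 , j≤) with k ≟ i
  ... | no ne = inj₁ (j≥1 , subst (j ≤_) (row-addCell-≢ α i k le ne) j≤)
  ... | yes refl with m≤n⇒m<n∨m≡n (subst (j ≤_) (row-addCell-≡ α k le) j≤)
  ...   | inj₁ lt   = inj₁ (j≥1 , ≤-pred lt)
  ...   | inj₂ refl = inj₂ refl

  InShape-ν⁺ : ∀ c → InShape α c ⊎ c ≡ b → InShape ν c
  InShape-ν⁺ (suc k , j) (inj₁ (a , q)) = a , ≤-trans q (⊆-addCell α i le k)
  InShape-ν⁺ .(suc i , suc (row α i)) (inj₂ refl) =
    s≤s z≤n , subst (suc (row α i) ≤_) (sym (row-addCell-≡ α i le)) ≤-refl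

  b∉α : ¬ InShape α b
  b∉α (_ , q) = <-irrefl refl q

  remove-skew : ∀ λ' → remove b (skewCells λ' α) ≡ skewCells λ' ν
  remove-skew λ' = trans (bfilter-∘ _ _ (cells λ')) (bfilter-ext _ _ (cells λ') outside-ν)
    where
    outside-ν : ∀ c → (not (inShape α c) ∧ not (c ==ᶜ b)) ≡ not (inShape ν c)
    outside-ν c = T-ext
      (λ t → T-not⁺ λ n → [ (λ a → T-not⁻ (T-∧₁ t) (inShape⁺ α c a))
                          , (λ e → T-not⁻ (T-∧₂ {not (inShape α c)} t) (≡⇒==ᶜ c b e)) ]′
                          (InShape-ν⁻ c (inShape⁻ ν c n)))
      (λ t → T-∧⁺ (T-not⁺ (λ a → T-not⁻ t (inShape⁺ ν c (InShape-ν⁺ c (inj₁ (inShape⁻ α c a))))))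
                  (T-not⁺ (λ e → T-not⁻ t (inShape⁺ ν c (InShape-ν⁺ c (inj₂ (==ᶜ⇒≡ c b e)))))))

  skew-ν-α : skewCells ν α ↭ b ∷ []
  skew-ν-α = unique-↭ (unique-skew ν α) (unique-∷ (λ ()) [])
    (λ c c∈ → let (inν , ∉α) = skew-∈⁻ ν α c c∈ in
       [ (λ a → ⊥-elim (∉α a)) , here ]′ (InShape-ν⁻ c inν))
    (λ { c (here refl) → skew-∈⁺ ν α b (InShape-ν⁺ b (inj₂ refl)) b∉α })

  cells-ν : cells ν ↭ b ∷ cells α
  cells-ν = unique-↭ (unique-cells ν) (unique-∷ (λ p → b∉α (cells-∈⁻ α b p)) (unique-cells α))
    (λ c c∈ → [ (λ a → there (cells-∈⁺ α c a)) , here ]′ (InShape-ν⁻ c (cells-∈⁻ ν c c∈)))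
    (λ { c (here refl) → cells-∈⁺ ν b (InShape-ν⁺ b (inj₂ refl))
       ; c (there p)   → cells-∈⁺ ν c (InShape-ν⁺ c (inj₁ (cells-∈⁻ α c p))) })

  count-cells-ν : ∀ p → count p (cells ν) ≡ δ (p b) + count p (cells α)
  count-cells-ν p = begin
    count p (cells ν)                          ≡⟨ count-∑ p (cells ν) ⟩
    ℕΣ.∑ (λ c → δ (p c)) (cells ν)             ≡⟨ ℕΣ.∑-↭ _ cells-ν ⟩
    δ (p b) + ℕΣ.∑ (λ c → δ (p c)) (cells α)   ≡⟨ cong (λ z → δ (p b) + z) (sym (count-∑ p (cells α))) ⟩
    δ (p b) + count p (cells α)                ∎

  u-addCell : u ν α ≡ count (b ◁_) (cells α)
  u-addCell = begin
    u ν α                                                ≡⟨ sum-map (skewCells ν α) ⟩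
    ℕΣ.∑ (λ c → count (c ◁_) (cells α)) (skewCells ν α)  ≡⟨ ℕΣ.∑-↭ _ skew-ν-α ⟩
    count (b ◁_) (cells α) + 0                           ≡⟨ +-identityʳ _ ⟩
    count (b ◁_) (cells α)                               ∎
    where
    sum-map : (xs : List Cell) → sum (map (λ c → count (c ◁_) (cells α)) xs) ≡ ℕΣ.∑ (λ c → count (c ◁_) (cells α)) xs
    sum-map []       = refl
    sum-map (x ∷ xs) = cong (λ z → count (x ◁_) (cells α) + z) (sum-map xs)

negOnePow-suc : ∀ b → negOnePow (suc b) ≡ ℤ.- (+ 1) ℤ.* negOnePow b
negOnePow-suc zero          = refl
negOnePow-suc (suc zero)    = refl
negOnePow-suc (suc (suc b)) = negOnePow-suc b

negOnePow-+ : ∀ a b → negOnePow (a + b) ≡ negOnePow a ℤ.* negOnePow b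
negOnePow-+ zero          b = sym (ℤP.*-identityˡ _)
negOnePow-+ (suc zero)    b = negOnePow-suc b
negOnePow-+ (suc (suc a)) b = negOnePow-+ a b

negOnePow-square : ∀ a → negOnePow a ℤ.* negOnePow a ≡ + 1
negOnePow-square zero          = refl
negOnePow-square (suc zero)    = refl
negOnePow-square (suc (suc a)) = negOnePow-square a

precedes : Cell → Cell → Bool
precedes (i , j) (i' , j') = ((i ≡ᵇ i') ∧ (j <ᵇ j')) ∨ ((j ≡ᵇ j') ∧ (i <ᵇ i'))

orderedPair : Cell × ℕ → Cell × ℕ → Bool
orderedPair (c , s) (c' , t) = not (precedes c c') ∨ (s <ᵇ t)

invertedPair : Cell × ℕ → Cell × ℕ → Bool
invertedPair (a , s) (b , t) = (a ◁ b) ∧ (t <ᵇ s)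

increasing-∑² : ∀ U → increasing U ≡ BoolΣ.∑² orderedPair U
increasing-∑² U = trans (foldr-∧ _ (allPairs U)) (trans (BoolΣ.∑-allPairs _ U) (BoolΣ.∑²-ext U (λ a c → refl)))

inversions-∑² : ∀ U → inversions U ≡ ℕΣ.∑² (λ x y → δ (invertedPair x y)) U
inversions-∑² U = trans (count-∑ _ (allPairs U)) (trans (ℕΣ.∑-allPairs _ U) (ℕΣ.∑²-ext U (λ a c → refl)))

cross : List Cell → List Cell → ℕ
cross cs as = ℕΣ.∑ (λ c → count (c ◁_) as) cs

-- Inversions of T₀ ⋄ U: those inside T₀, those inside U, and the pairs
-- (cell of U, cell of T₀) in ◁-order, since every entry of T₀ ⋄ U coming
-- from U exceeds every entry of T₀.
inversions-⋄ : ∀ T₀ U → All (λ a → proj₂ a ≤ length T₀) T₀ → All (λ x → 1 ≤ proj₂ x) U →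
  inversions (T₀ ⋄ U) ≡ inversions T₀ + (inversions U + cross (map proj₁ U) (map proj₁ T₀))
inversions-⋄ T₀ U = go _ (λ x → refl)
  where
  k : ℕ
  k = length T₀
  inv : Cell × ℕ → Cell × ℕ → ℕ
  inv x y = δ (invertedPair x y)
  -- The shift used by _⋄_, abstracted so that it can be named.
  go : ∀ (shift : Cell × ℕ → Cell × ℕ) → (∀ x → shift x ≡ (proj₁ x , proj₂ x + k)) →
    All (λ a → proj₂ a ≤ k) T₀ → All (λ x → 1 ≤ proj₂ x) U →
    inversions (T₀ ++ map shift U) ≡ inversions T₀ + (inversions U + cross (map proj₁ U) (map proj₁ T₀))
  go shift shift≡ small large = begin
    inversions (T₀ ++ M)
      ≡⟨ inversions-∑² (T₀ ++ M) ⟩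
    ℕΣ.∑² inv (T₀ ++ M)
      ≡⟨ ℕΣ.∑²-++ inv T₀ M ⟩
    (ℕΣ.∑² inv T₀ + ℕΣ.∑ (λ a → ℕΣ.∑ (inv a) M) T₀) + (ℕΣ.∑ (λ b → ℕΣ.∑ (inv b) T₀) M + ℕΣ.∑² inv M)
      ≡⟨ cong₂ (λ x y → (ℕΣ.∑² inv T₀ + x) + y) T₀-before-M (cong₂ _+_ M-before-T₀ within-M) ⟩
    (ℕΣ.∑² inv T₀ + 0) + (cr + inversions U)
      ≡⟨ cong₂ _+_ (trans (+-identityʳ _) (sym (inversions-∑² T₀))) (+-comm cr (inversions U)) ⟩
    inversions T₀ + (inversions U + cr) ∎
    where
    M : Tab
    M = map shift U
    cr : ℕ
    cr = cross (map proj₁ U) (map proj₁ T₀)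
    entry-not< : ∀ s t → s ≤ k → (t + k <ᵇ s) ≡ false
    entry-not< s t s≤k with t + k <ᵇ s in eq
    ... | false = refl
    ... | true  = ⊥-elim (<-irrefl refl (≤-trans (<ᵇ⇒< _ _ (subst T (sym eq) tt)) (≤-trans s≤k (m≤n+m k t))))
    entry-< : ∀ s t → s ≤ k → 1 ≤ t → (s <ᵇ t + k) ≡ true
    entry-< s (suc t) s≤k _ = T-≡true (<⇒<ᵇ (s≤s (≤-trans s≤k (m≤n+m k t))))
    T₀-before-M : ℕΣ.∑ (λ a → ℕΣ.∑ (inv a) M) T₀ ≡ 0
    T₀-before-M = ℕΣ.∑-vanish T₀ (λ a a∈ → trans (ℕΣ.∑-map (inv a) shift U)
      (ℕΣ.∑-vanish U (λ x _ → trans (cong (inv a) (shift≡ x))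
        (trans (cong (λ z → δ ((proj₁ a ◁ proj₁ x) ∧ z)) (entry-not< (proj₂ a) (proj₂ x) (All.lookup small a∈)))
               (cong δ (∧-zeroʳ (proj₁ a ◁ proj₁ x)))))))
    M-before-T₀ : ℕΣ.∑ (λ b → ℕΣ.∑ (inv b) T₀) M ≡ cr
    M-before-T₀ = trans (ℕΣ.∑-map (λ b → ℕΣ.∑ (inv b) T₀) shift U)
      (trans (ℕΣ.∑-cong U (λ x x∈ → trans (ℕΣ.∑-cong T₀ (λ a a∈ →
          trans (cong (λ z → inv z a) (shift≡ x))
          (trans (cong (λ z → δ ((proj₁ x ◁ proj₁ a) ∧ z)) (entry-< (proj₂ a) (proj₂ x) (All.lookup small a∈) (All.lookup large x∈)))
                 (cong δ (∧-identityʳ (proj₁ x ◁ proj₁ a))))))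
        (trans (sym (ℕΣ.∑-map (λ c → δ (proj₁ x ◁ c)) proj₁ T₀)) (sym (count-∑ (proj₁ x ◁_) (map proj₁ T₀))))))
      (sym (ℕΣ.∑-map (λ c → count (c ◁_) (map proj₁ T₀)) proj₁ U)))
    within-M : ℕΣ.∑² inv M ≡ inversions U
    within-M = trans (ℕΣ.∑²-map inv shift U)
      (trans (ℕΣ.∑²-ext U (λ x y → trans (cong₂ inv (shift≡ x) (shift≡ y))
                (cong (λ z → δ ((proj₁ x ◁ proj₁ y) ∧ z)) (<ᵇ-+ʳ (proj₂ y) (proj₂ x) k))))
      (sym (inversions-∑² U)))

module ReferenceTableau (μ : List ℕ) where

  private
    lengths≡ : length (cells μ) ≡ length (range 1 (sum μ))
    lengths≡ = trans (length-cellsFrom 1 μ) (sym (length-range 1 (sum μ)))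

  length-T₀ : length (T₀ μ) ≡ sum μ
  length-T₀ = trans (length-zip (cells μ) (range 1 (sum μ)) lengths≡) (length-cellsFrom 1 μ)

  cells-T₀ : map proj₁ (T₀ μ) ≡ cells μ
  cells-T₀ = map-proj₁-zip (cells μ) (range 1 (sum μ)) lengths≡

  entries-T₀ : All (λ a → proj₂ a ≤ length (T₀ μ)) (T₀ μ)
  entries-T₀ = subst (λ z → All (λ a → proj₂ a ≤ z) (T₀ μ)) (sym length-T₀)
    (All-zip₂ (cells μ) (range 1 (sum μ)) (All.tabulate (λ p → ≤-pred (proj₂ (range-∈⁻ 1 (sum μ) p)))))

signedWeight : List ℕ → Tab → ℤ
signedWeight μ T = negOnePow (inversions T + cross (map proj₁ T) (cells μ))

-- For a filling with positive entries, Defs' signSkew μ equals signedWeight μ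
-- (the sign of T₀ μ cancels against itself).
signSkew≡signedWeight : ∀ μ U → All (λ x → 1 ≤ proj₂ x) U → signSkew μ U ≡ signedWeight μ U
signSkew≡signedWeight μ U pos = begin
  negOnePow i₀ ℤ.* negOnePow (inversions (T₀ μ ⋄ U))
    ≡⟨ cong (λ z → negOnePow i₀ ℤ.* negOnePow z) (inversions-⋄ (T₀ μ) U entries-T₀ pos) ⟩
  negOnePow i₀ ℤ.* negOnePow (i₀ + rest)
    ≡⟨ cong (negOnePow i₀ ℤ.*_) (negOnePow-+ i₀ rest) ⟩
  negOnePow i₀ ℤ.* (negOnePow i₀ ℤ.* negOnePow rest)
    ≡⟨ sym (ℤP.*-assoc (negOnePow i₀) _ _) ⟩
  (negOnePow i₀ ℤ.* negOnePow i₀) ℤ.* negOnePow rest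
    ≡⟨ cong (ℤ._* negOnePow rest) (negOnePow-square i₀) ⟩
  + 1 ℤ.* negOnePow rest
    ≡⟨ ℤP.*-identityˡ _ ⟩
  negOnePow rest
    ≡⟨ cong (λ z → negOnePow (inversions U + cross (map proj₁ U) z)) cells-T₀ ⟩
  signedWeight μ U ∎
  where
  open ReferenceTableau μ
  i₀ : ℕ
  i₀ = inversions (T₀ μ)
  rest : ℕ
  rest = inversions U + cross (map proj₁ U) (map proj₁ (T₀ μ))

weight : List ℕ → Tab → ℤ
weight μ U = ℤΣ.when (increasing U) (signedWeight μ U)

weight-↭ : ∀ μ {U U'} → U ↭ U' → weight μ U ≡ weight μ U'
weight-↭ μ {U} {U'} p = cong₂ ℤΣ.when
  (trans (increasing-∑² U) (trans (BoolΣ.∑²-↭ orderedPair p) (sym (increasing-∑² U'))))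
  (cong negOnePow (cong₂ _+_
    (trans (inversions-∑² U) (trans (ℕΣ.∑²-↭ _ p) (sym (inversions-∑² U'))))
    (ℕΣ.∑-↭ (λ c → count (c ◁_) (cells μ)) (PermP.map⁺ proj₁ p))))

weight-addCell : ∀ α i → (le : i ≤ length α) → ∀ U →
  weight (addCell α i) U ≡ negOnePow (count (_◁ newCell α i) (map proj₁ U)) ℤ.* weight α U
weight-addCell α i le U = begin
  ℤΣ.when (increasing U) (negOnePow (inversions U + cross cs (cells (addCell α i))))
    ≡⟨ cong (λ z → ℤΣ.when (increasing U) (negOnePow (inversions U + z))) cross-ν ⟩
  ℤΣ.when (increasing U) (negOnePow (inversions U + (before + cross cs (cells α))))
    ≡⟨ cong (λ z → ℤΣ.when (increasing U) (negOnePow z)) (swap-front (inversions U) before _) ⟩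
  ℤΣ.when (increasing U) (negOnePow (before + (inversions U + cross cs (cells α))))
    ≡⟨ cong (ℤΣ.when (increasing U)) (negOnePow-+ before _) ⟩
  ℤΣ.when (increasing U) (negOnePow before ℤ.* signedWeight α U)
    ≡⟨ ℤ*-when (increasing U) (negOnePow before) _ ⟩
  negOnePow before ℤ.* weight α U ∎
  where
  open AddedCell α i le
  cs : List Cell
  cs = map proj₁ U
  before : ℕ
  before = count (_◁ b) cs
  swap-front : ∀ a b c → a + (b + c) ≡ b + (a + c)
  swap-front a b c = trans (sym (+-assoc a b c)) (trans (cong (_+ c) (+-comm a b)) (+-assoc b a c))
  cross-ν : cross cs (cells ν) ≡ before + cross cs (cells α)
  cross-ν = begin
    ℕΣ.∑ (λ c → count (c ◁_) (cells ν)) cs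
      ≡⟨ ℕΣ.∑-ext cs (λ c → count-cells-ν (c ◁_)) ⟩
    ℕΣ.∑ (λ c → δ (c ◁ b) + count (c ◁_) (cells α)) cs
      ≡⟨ ℕΣ.∑-⊕ (λ c → δ (c ◁ b)) (λ c → count (c ◁_) (cells α)) cs ⟩
    ℕΣ.∑ (λ c → δ (c ◁ b)) cs + cross cs (cells α)
      ≡⟨ cong (_+ cross cs (cells α)) (sym (count-∑ (_◁ b) cs)) ⟩
    before + cross cs (cells α) ∎

insertions-map-suc : ∀ x ys → insertions (suc x) (map suc ys) ≡ map (map suc) (insertions x ys)
insertions-map-suc x []       = refl
insertions-map-suc x (y ∷ ys) = cong ((suc x ∷ suc y ∷ map suc ys) ∷_)
  (trans (cong (map (suc y ∷_)) (insertions-map-suc x ys))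
  (trans (sym (ListP.map-∘ (insertions x ys))) (ListP.map-∘ (insertions x ys))))

perms-map-suc : ∀ ys → perms (map suc ys) ≡ map (map suc) (perms ys)
perms-map-suc []       = refl
perms-map-suc (y ∷ ys) = trans (cong (concatMap (insertions (suc y))) (perms-map-suc ys)) (concatMap-suc (perms ys))
  where
  concatMap-suc : ∀ zs → concatMap (insertions (suc y)) (map (map suc) zs) ≡ map (map suc) (concatMap (insertions y) zs)
  concatMap-suc []       = refl
  concatMap-suc (z ∷ zs) = trans (cong₂ _++_ (insertions-map-suc y z) (concatMap-suc zs))
    (sym (ListP.map-++ (map suc) (insertions y z) (concatMap (insertions y) zs)))

perms-range : ∀ L → perms (range 1 (suc L)) ≡ concatMap (insertions 1) (map (map suc) (perms (range 1 L)))
perms-range L = cong (concatMap (insertions 1)) (trans (cong perms (range-suc 1 L)) (perms-map-suc (range 1 L)))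

insertions-shape : {P : ℕ → Set} → ∀ x ys → P x → All P ys →
  All (λ w → length w ≡ suc (length ys) × All P w) (insertions x ys)
insertions-shape x []       px _           = (refl , (px ∷ [])) ∷ []
insertions-shape x (y ∷ ys) px (py ∷ pys) = (refl , (px ∷ py ∷ pys)) ∷
  All.tabulate (λ {w} w∈ → let (v , v∈ , e) = ∈-map⁻ (y ∷_) w∈
                               (l , a) = All.lookup (insertions-shape x ys px pys) v∈
                           in subst (λ z → length z ≡ suc (suc (length ys)) × All _ z) (sym e) (cong suc l , py ∷ a))

perms-shape : {P : ℕ → Set} → ∀ xs → All P xs → All (λ σ → length σ ≡ length xs × All P σ) (perms xs)
perms-shape []       _          = (refl , []) ∷ []
perms-shape (x ∷ xs) (px ∷ pxs) = All.tabulate λ {w} w∈ →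
  let (σ , σ∈ , w∈') = ∈-concatMap⁻′ (insertions x) (perms xs) w∈
      (l , a)   = All.lookup (perms-shape xs pxs) σ∈
      (l' , a') = All.lookup (insertions-shape x σ px a) w∈'
  in trans l' (cong suc l) , a'

perm-range-length : ∀ L {σ} → σ ∈ perms (range 1 L) → length σ ≡ L
perm-range-length L σ∈ =
  trans (proj₁ (All.lookup (perms-shape (range 1 L) (All.tabulate (λ p → proj₁ (range-∈⁻ 1 L p)))) σ∈)) (length-range 1 L)

perm-range-positive : ∀ L {σ} → σ ∈ perms (range 1 L) → All (1 ≤_) σ
perm-range-positive L σ∈ = proj₂ (All.lookup (perms-shape (range 1 L) (All.tabulate (λ p → proj₁ (range-∈⁻ 1 L p)))) σ∈)

-- Inserting x at every position of ys and zipping with the distinct cells cs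
-- amounts to choosing the cell b receiving x and zipping the other cells
-- with ys (for a function H of fillings that ignores list order).
∑-insertions : (H : Tab → ℤ) → (∀ {U U'} → U ↭ U' → H U ≡ H U') → ∀ x ys cs → Unique cs →
  length cs ≡ suc (length ys) →
  ℤΣ.∑ (λ w → H (zip cs w)) (insertions x ys) ≡ ℤΣ.∑ (λ b → H ((b , x) ∷ zip (remove b cs) ys)) cs
∑-insertions H H-↭ x [] (c ∷ []) u _ =
  cong (λ z → H ((c , x) ∷ z) ℤ.+ + 0) (sym (ListP.zipWith-zeroʳ _,_ (remove c (c ∷ []))))
∑-insertions H H-↭ x (y ∷ ys) (c ∷ cs) u e = cong₂ ℤ._+_ x-at-c x-after-c
  where
  c∉ : c ∉ cs
  c∉ = unique-head u
  x-at-c : H ((c , x) ∷ zip cs (y ∷ ys)) ≡ H ((c , x) ∷ zip (remove c (c ∷ cs)) (y ∷ ys))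
  x-at-c = cong (λ z → H ((c , x) ∷ zip z (y ∷ ys))) (sym (trans (remove-head c cs) (remove-∉ c cs c∉)))
  x-after-c : ℤΣ.∑ (λ w → H (zip (c ∷ cs) w)) (map (y ∷_) (insertions x ys))
            ≡ ℤΣ.∑ (λ b → H ((b , x) ∷ zip (remove b (c ∷ cs)) (y ∷ ys))) cs
  x-after-c = begin
    ℤΣ.∑ (λ w → H (zip (c ∷ cs) w)) (map (y ∷_) (insertions x ys))
      ≡⟨ ℤΣ.∑-map (λ w → H (zip (c ∷ cs) w)) (y ∷_) (insertions x ys) ⟩
    ℤΣ.∑ (λ w → H ((c , y) ∷ zip cs w)) (insertions x ys)
      ≡⟨ ∑-insertions (λ U → H ((c , y) ∷ U)) (λ p → H-↭ (Perm.prep (c , y) p)) x ys cs (unique-tail u) (suc-injective e) ⟩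
    ℤΣ.∑ (λ b → H ((c , y) ∷ (b , x) ∷ zip (remove b cs) ys)) cs
      ≡⟨ ℤΣ.∑-cong cs (λ b b∈ → trans (H-↭ (Perm.swap (c , y) (b , x) Perm.refl))
           (cong (λ z → H ((b , x) ∷ zip z (y ∷ ys)))
                 (sym (remove-≢ b c cs (λ c≡b → c∉ (subst (_∈ cs) (sym c≡b) b∈)))))) ⟩
    ℤΣ.∑ (λ b → H ((b , x) ∷ zip (remove b (c ∷ cs)) (y ∷ ys))) cs ∎

I-as-∑ : ∀ λ' μ → I λ' μ ≡ ℤΣ.∑ (λ σ → weight μ (zip (skewCells λ' μ) σ)) (perms (range 1 (length (skewCells λ' μ))))
I-as-∑ λ' μ = begin
  I λ' μ
    ≡⟨ foldr-ℤ _ (SYTs λ' μ) ⟩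
  ℤΣ.∑ (signSkew μ) (bfilter increasing (map (zip cs) Σn))
    ≡⟨ ℤΣ.∑-bfilter (signSkew μ) increasing (map (zip cs) Σn) ⟩
  ℤΣ.∑ (λ U → ℤΣ.when (increasing U) (signSkew μ U)) (map (zip cs) Σn)
    ≡⟨ ℤΣ.∑-map (λ U → ℤΣ.when (increasing U) (signSkew μ U)) (zip cs) Σn ⟩
  ℤΣ.∑ (λ σ → ℤΣ.when (increasing (zip cs σ)) (signSkew μ (zip cs σ))) Σn
    ≡⟨ ℤΣ.∑-cong Σn (λ σ σ∈ → cong (ℤΣ.when (increasing (zip cs σ)))
         (signSkew≡signedWeight μ (zip cs σ) (All-zip₂ cs σ (perm-range-positive (length cs) σ∈)))) ⟩
  ℤΣ.∑ (λ σ → weight μ (zip cs σ)) Σn ∎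
  where
  cs : List Cell
  cs = skewCells λ' μ
  Σn : List (List ℕ)
  Σn = perms (range 1 (length cs))

I-by-cell-of-1 : ∀ λ' α L → length (skewCells λ' α) ≡ suc L →
  I λ' α ≡ ℤΣ.∑ (λ b → ℤΣ.∑ (λ τ → weight α ((b , 1) ∷ zip (remove b (skewCells λ' α)) (map suc τ))) (perms (range 1 L)))
                (skewCells λ' α)
I-by-cell-of-1 λ' α L e = begin
  I λ' α
    ≡⟨ I-as-∑ λ' α ⟩
  ℤΣ.∑ H (perms (range 1 (length cs)))
    ≡⟨ cong (λ n → ℤΣ.∑ H (perms (range 1 n))) e ⟩
  ℤΣ.∑ H (perms (range 1 (suc L)))
    ≡⟨ cong (ℤΣ.∑ H) (perms-range L) ⟩
  ℤΣ.∑ H (concatMap (insertions 1) (map (map suc) (perms (range 1 L))))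
    ≡⟨ ℤΣ.∑-concatMap H (insertions 1) (map (map suc) (perms (range 1 L))) ⟩
  ℤΣ.∑ (λ w → ℤΣ.∑ H (insertions 1 w)) (map (map suc) (perms (range 1 L)))
    ≡⟨ ℤΣ.∑-map (λ w → ℤΣ.∑ H (insertions 1 w)) (map suc) (perms (range 1 L)) ⟩
  ℤΣ.∑ (λ τ → ℤΣ.∑ H (insertions 1 (map suc τ))) (perms (range 1 L))
    ≡⟨ ℤΣ.∑-cong (perms (range 1 L)) (λ τ τ∈ →
         ∑-insertions (weight α) (weight-↭ α) 1 (map suc τ) cs (unique-skew λ' α)
           (trans e (cong suc (sym (trans (ListP.length-map suc τ) (perm-range-length L τ∈)))))) ⟩
  ℤΣ.∑ (λ τ → ℤΣ.∑ (λ b → weight α ((b , 1) ∷ zip (remove b cs) (map suc τ))) cs) (perms (range 1 L))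
    ≡⟨ ℤΣ.∑-swap (λ τ b → weight α ((b , 1) ∷ zip (remove b cs) (map suc τ))) (perms (range 1 L)) cs ⟩
  ℤΣ.∑ (λ b → ℤΣ.∑ (λ τ → weight α ((b , 1) ∷ zip (remove b cs) (map suc τ))) (perms (range 1 L))) cs ∎
  where
  cs : List Cell
  cs = skewCells λ' α
  H : List ℕ → ℤ
  H σ = weight α (zip cs σ)

isMinimal : Cell → List Cell → Bool
isMinimal b cs = BoolΣ.∑ (λ c → not (precedes c b)) cs

precedes-irrefl : ∀ c → precedes c c ≡ false
precedes-irrefl (i , j) rewrite n<ᵇn i | n<ᵇn j | ∧-zeroʳ (i ≡ᵇ i) | ∧-zeroʳ (j ≡ᵇ j) = refl

raise : Cell × ℕ → Cell × ℕ
raise (c , t) = (c , suc t)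

zip-map-suc : (r : List Cell) (τ : List ℕ) → zip r (map suc τ) ≡ map raise (zip r τ)
zip-map-suc []      τ       = refl
zip-map-suc (c ∷ r) []      = refl
zip-map-suc (c ∷ r) (t ∷ τ) = cong ((c , suc t) ∷_) (zip-map-suc r τ)

1<ᵇsuc : ∀ t → 1 ≤ t → (0 <ᵇ t) ≡ true
1<ᵇsuc (suc t) _ = refl

increasing-put-1 : ∀ b U → All (λ x → 1 ≤ proj₂ x) U →
  increasing ((b , 1) ∷ map raise U) ≡ isMinimal b (map proj₁ U) ∧ increasing U
increasing-put-1 b U pos = begin
  increasing ((b , 1) ∷ map raise U)
    ≡⟨ increasing-∑² ((b , 1) ∷ map raise U) ⟩
  BoolΣ.∑² orderedPair ((b , 1) ∷ map raise U)
    ≡⟨ BoolΣ.∑²-cons orderedPair (b , 1) (map raise U) ⟩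
  (orderedPair (b , 1) (b , 1) ∧ (BoolΣ.∑ (orderedPair (b , 1)) (map raise U)
      ∧ BoolΣ.∑ (λ a → orderedPair a (b , 1)) (map raise U))) ∧ BoolΣ.∑² orderedPair (map raise U)
    ≡⟨ cong₂ _∧_ (cong₂ _∧_ diagonal (cong₂ _∧_ b-first U-first)) rest ⟩
  isMinimal b (map proj₁ U) ∧ increasing U ∎
  where
  diagonal : orderedPair (b , 1) (b , 1) ≡ true
  diagonal rewrite precedes-irrefl b = refl
  b-first : BoolΣ.∑ (orderedPair (b , 1)) (map raise U) ≡ true
  b-first = trans (BoolΣ.∑-map (orderedPair (b , 1)) raise U)
    (BoolΣ.∑-vanish U (λ x x∈ → trans (cong (λ z → not (precedes b (proj₁ x)) ∨ z) (1<ᵇsuc (proj₂ x) (All.lookup pos x∈)))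
                                      (∨-zeroʳ _)))
  U-first : BoolΣ.∑ (λ a → orderedPair a (b , 1)) (map raise U) ≡ isMinimal b (map proj₁ U)
  U-first = trans (BoolΣ.∑-map (λ a → orderedPair a (b , 1)) raise U)
    (trans (BoolΣ.∑-ext U (λ x → ∨-identityʳ _)) (sym (BoolΣ.∑-map (λ c → not (precedes c b)) proj₁ U)))
  rest : BoolΣ.∑² orderedPair (map raise U) ≡ increasing U
  rest = trans (BoolΣ.∑²-map orderedPair raise U) (sym (increasing-∑² U))

inversions-put-1 : ∀ b U → All (λ x → 1 ≤ proj₂ x) U →
  inversions ((b , 1) ∷ map raise U) ≡ count (_◁ b) (map proj₁ U) + inversions U
inversions-put-1 b U pos = begin
  inversions ((b , 1) ∷ map raise U)
    ≡⟨ inversions-∑² ((b , 1) ∷ map raise U) ⟩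
  ℕΣ.∑² inv ((b , 1) ∷ map raise U)
    ≡⟨ ℕΣ.∑²-cons inv (b , 1) (map raise U) ⟩
  (inv (b , 1) (b , 1) + (ℕΣ.∑ (inv (b , 1)) (map raise U) + ℕΣ.∑ (λ a → inv a (b , 1)) (map raise U)))
    + ℕΣ.∑² inv (map raise U)
    ≡⟨ cong₂ (λ x y → (x + y) + ℕΣ.∑² inv (map raise U)) diagonal (cong₂ _+_ b-first U-first) ⟩
  (0 + (0 + count (_◁ b) (map proj₁ U))) + ℕΣ.∑² inv (map raise U)
    ≡⟨ cong (λ z → count (_◁ b) (map proj₁ U) + z) rest ⟩
  count (_◁ b) (map proj₁ U) + inversions U ∎
  where
  inv : Cell × ℕ → Cell × ℕ → ℕ
  inv x y = δ (invertedPair x y)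
  diagonal : inv (b , 1) (b , 1) ≡ 0
  diagonal = cong δ (∧-zeroʳ (b ◁ b))
  b-first : ℕΣ.∑ (inv (b , 1)) (map raise U) ≡ 0
  b-first = trans (ℕΣ.∑-map (inv (b , 1)) raise U) (ℕΣ.∑-vanish U (λ x _ → cong δ (∧-zeroʳ _)))
  U-first : ℕΣ.∑ (λ a → inv a (b , 1)) (map raise U) ≡ count (_◁ b) (map proj₁ U)
  U-first = begin
    ℕΣ.∑ (λ a → inv a (b , 1)) (map raise U)
      ≡⟨ ℕΣ.∑-map (λ a → inv a (b , 1)) raise U ⟩
    ℕΣ.∑ (λ x → δ ((proj₁ x ◁ b) ∧ (0 <ᵇ proj₂ x))) U
      ≡⟨ ℕΣ.∑-cong U (λ x x∈ → cong (λ z → δ ((proj₁ x ◁ b) ∧ z)) (1<ᵇsuc (proj₂ x) (All.lookup pos x∈))) ⟩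
    ℕΣ.∑ (λ x → δ ((proj₁ x ◁ b) ∧ true)) U
      ≡⟨ ℕΣ.∑-ext U (λ x → cong δ (∧-identityʳ _)) ⟩
    ℕΣ.∑ (λ x → δ (proj₁ x ◁ b)) U
      ≡⟨ sym (ℕΣ.∑-map (λ c → δ (c ◁ b)) proj₁ U) ⟩
    ℕΣ.∑ (λ c → δ (c ◁ b)) (map proj₁ U)
      ≡⟨ sym (count-∑ (_◁ b) (map proj₁ U)) ⟩
    count (_◁ b) (map proj₁ U) ∎
  rest : ℕΣ.∑² inv (map raise U) ≡ inversions U
  rest = trans (ℕΣ.∑²-map inv raise U) (sym (inversions-∑² U))

weight-put-1 : ∀ α b r τ → length r ≡ length τ → All (1 ≤_) τ →
  weight α ((b , 1) ∷ zip r (map suc τ))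
    ≡ ℤΣ.when (isMinimal b r) (negOnePow (count (_◁ b) r + count (b ◁_) (cells α)) ℤ.* weight α (zip r τ))
weight-put-1 α b r τ lengths pos = begin
  weight α ((b , 1) ∷ zip r (map suc τ))
    ≡⟨ cong (λ U′ → weight α ((b , 1) ∷ U′)) (zip-map-suc r τ) ⟩
  ℤΣ.when (increasing ((b , 1) ∷ map raise U))
          (negOnePow (inversions ((b , 1) ∷ map raise U) + (cb + cross (map proj₁ (map raise U)) (cells α))))
    ≡⟨ cong₂ ℤΣ.when (increasing-put-1 b U posU)
         (cong negOnePow (cong₂ _+_ (inversions-put-1 b U posU)
           (cong (λ l → cb + cross l (cells α)) (sym (ListP.map-∘ U))))) ⟩
  ℤΣ.when (isMinimal b cs ∧ increasing U) (negOnePow ((cL + inversions U) + (cb + crU)))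
    ≡⟨ cong (ℤΣ.when (isMinimal b cs ∧ increasing U))
         (trans (cong negOnePow (ℕΣ.⊕-interchange cL (inversions U) cb crU)) (negOnePow-+ (cL + cb) (inversions U + crU))) ⟩
  ℤΣ.when (isMinimal b cs ∧ increasing U) (negOnePow (cL + cb) ℤ.* signedWeight α U)
    ≡⟨ when-∧ (isMinimal b cs) (increasing U) (negOnePow (cL + cb)) (signedWeight α U) ⟩
  ℤΣ.when (isMinimal b cs) (negOnePow (cL + cb) ℤ.* weight α U)
    ≡⟨ cong (λ l → ℤΣ.when (isMinimal b l) (negOnePow (count (_◁ b) l + cb) ℤ.* weight α U)) cs≡r ⟩
  ℤΣ.when (isMinimal b r) (negOnePow (count (_◁ b) r + cb) ℤ.* weight α U) ∎
  where
  U : Tab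
  U = zip r τ
  cs : List Cell
  cs = map proj₁ U
  posU : All (λ x → 1 ≤ proj₂ x) U
  posU = All-zip₂ r τ pos
  cs≡r : cs ≡ r
  cs≡r = map-proj₁-zip r τ lengths
  cL : ℕ
  cL = count (_◁ b) cs
  cb : ℕ
  cb = count (b ◁_) (cells α)
  crU : ℕ
  crU = cross cs (cells α)

precedes⇒ : ∀ c b → T (precedes c b) →
  (proj₁ c ≡ proj₁ b × proj₂ c < proj₂ b) ⊎ (proj₂ c ≡ proj₂ b × proj₁ c < proj₁ b)
precedes⇒ (i , j) (i' , j') p with Equivalence.to (T-∨ {(i ≡ᵇ i') ∧ (j <ᵇ j')}) p
... | inj₁ q = inj₁ (≡ᵇ⇒≡ i i' (T-∧₁ q) , <ᵇ⇒< j j' (T-∧₂ {i ≡ᵇ i'} q))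
... | inj₂ q = inj₂ (≡ᵇ⇒≡ j j' (T-∧₁ q) , <ᵇ⇒< i i' (T-∧₂ {j ≡ᵇ j'} q))

left-precedes : ∀ i j j' → j < j' → T (precedes (i , j) (i , j'))
left-precedes i j j' lt = T-∨₁ (T-∧⁺ (≡⇒≡ᵇ i i refl) (<⇒<ᵇ lt))

above-precedes : ∀ i i' j → i < i' → T (precedes (i , j) (i' , j))
above-precedes i i' j lt = T-∨₂ {(i ≡ᵇ i') ∧ (j <ᵇ j)} (T-∧⁺ (≡⇒≡ᵇ j j refl) (<⇒<ᵇ lt))

module MinimalCells (α λ' : List ℕ) (dα : Decreasing α) (dλ : Decreasing λ') (α⊆λ : α ⊆ λ') where

  cs : List Cell
  cs = skewCells λ' α

  minimal : Cell → Bool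
  minimal b = isMinimal b (remove b cs)

  fittingRows : List ℕ
  fittingRows = bfilter (λ i → addCell α i ⊆ᵇ λ') (addableRows α)

  unpreceded : ∀ b → T (minimal b) → ∀ c → c ∈ cs → c ≢ b → ¬ T (precedes c b)
  unpreceded b m c c∈ c≢b = T-not⁻ (BoolΣ-all⁻ (remove b cs) m c (remove-∈⁺ b cs c∈ c≢b))

  outside-α : ∀ i j → (suc i , j) ∈ cs → row α i < j
  outside-α i j b∈ = ≰⇒> (λ q → proj₂ (skew-∈⁻ λ' α _ b∈) (proj₁ (proj₁ (skew-∈⁻ λ' α _ b∈)) , q))

  pred< : ∀ j → 1 ≤ j → pred j < j
  pred< (suc j) _ = ≤-refl

  minimal-column : ∀ i j → (suc i , j) ∈ cs → T (minimal (suc i , j)) → j ≡ suc (row α i)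
  minimal-column i j b∈ m with m≤n⇒m<n∨m≡n (outside-α i j b∈)
  ... | inj₂ e  = sym e
  ... | inj₁ lt = ⊥-elim (unpreceded (suc i , j) m (suc i , pred j) left∈ left≢ (left-precedes (suc i) (pred j) j pj<j))
    where
    inλ : InShape λ' (suc i , j)
    inλ = proj₁ (skew-∈⁻ λ' α _ b∈)
    pj<j : pred j < j
    pj<j = pred< j (proj₁ inλ)
    αᵢ<pj : suc (row α i) ≤ pred j
    αᵢ<pj = pred-mono-≤ lt
    left∈ : (suc i , pred j) ∈ cs
    left∈ = skew-∈⁺ λ' α (suc i , pred j) (≤-trans (s≤s z≤n) αᵢ<pj , ≤-trans (<⇒≤ pj<j) (proj₂ inλ))
      (λ q → <-irrefl refl (≤-trans (s≤s (proj₂ q)) αᵢ<pj))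
    left≢ : (suc i , pred j) ≢ (suc i , j)
    left≢ e = <-irrefl (cong proj₂ e) pj<j

  -- … and row i is addable (otherwise the cell above would precede it).
  minimal-addable : ∀ i → (suc i , suc (row α i)) ∈ cs → T (minimal (suc i , suc (row α i))) →
    i ≤ length α × T (addable α i)
  minimal-addable zero      b∈ m = z≤n , tt
  minimal-addable (suc i') b∈ m with row α (suc i') <? row α i'
  ... | yes lt  = row-length α i' (≤-<-trans z≤n lt) , <⇒<ᵇ lt
  ... | no ¬lt = ⊥-elim (unpreceded b m (suc i' , j) above∈ above≢ (above-precedes (suc i') (suc (suc i')) j ≤-refl))
    where
    j : ℕ
    j = suc (row α (suc i'))
    b : Cell
    b = (suc (suc i') , j)
    inλ : InShape λ' b
    inλ = proj₁ (skew-∈⁻ λ' α _ b∈)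
    above∈ : (suc i' , j) ∈ cs
    above∈ = skew-∈⁺ λ' α (suc i' , j) (s≤s z≤n , ≤-trans (proj₂ inλ) (row-step λ' dλ i'))
      (λ q → <-irrefl refl (≤-trans (s≤s (≮⇒≥ ¬lt)) (proj₂ q)))
    above≢ : (suc i' , j) ≢ b
    above≢ e = <-irrefl (cong proj₁ e) ≤-refl

  minimal⇒newCell : ∀ b → b ∈ cs → T (minimal b) → Σ ℕ λ i → i ∈ fittingRows × b ≡ newCell α i
  minimal⇒newCell (zero  , j) b∈ m = ⊥-elim (proj₁ (skew-∈⁻ λ' α _ b∈))
  minimal⇒newCell (suc i , j) b∈ m with minimal-column i j b∈ m
  ... | refl =
    let (le , ok) = minimal-addable i b∈ m
        fits = addCell-⊆ α λ' i le α⊆λ (proj₂ (proj₁ (skew-∈⁻ λ' α _ b∈)))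
    in i , ∈-bfilter⁺ _ (addableRows α) (addableRows-∈⁺ α le ok) (⊆⇒⊆ᵇ (addCell α i) λ' fits) , refl

  newCell⇒minimal : ∀ i → i ∈ fittingRows → newCell α i ∈ cs × T (minimal (newCell α i))
  newCell⇒minimal i i∈ = b∈ , BoolΣ-all⁺ (remove b cs) not-preceded
    where
    b : Cell
    b = newCell α i
    i∈′ : i ∈ addableRows α × T (addCell α i ⊆ᵇ λ')
    i∈′ = ∈-bfilter⁻ _ (addableRows α) i∈
    le : i ≤ length α
    le = proj₁ (addableRows-∈⁻ α (proj₁ i∈′))
    ok : T (addable α i)
    ok = proj₂ (addableRows-∈⁻ α (proj₁ i∈′))
    b∈ : b ∈ cs
    b∈ = skew-∈⁺ λ' α b
      (s≤s z≤n , subst (_≤ row λ' i) (row-addCell-≡ α i le) (⊆ᵇ⇒⊆ (addCell α i) λ' (proj₂ i∈′) i))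
      (λ q → <-irrefl refl (proj₂ q))
    -- A cell preceding b lies left of b in row i+1 or above b in column
    -- row α i + 1; either way it would be a cell of α.
    not-preceded : ∀ c → c ∈ remove b cs → T (not (precedes c b))
    not-preceded c c∈ with remove-∈⁻ b cs c∈
    not-preceded (zero  , j₂) _ | c∈cs , _ = ⊥-elim (proj₁ (skew-∈⁻ λ' α _ c∈cs))
    not-preceded (suc i₂ , j₂) _ | c∈cs , _ =
      T-not⁺ λ p → proj₂ (skew-∈⁻ λ' α _ c∈cs) (j≥1 , in-α (precedes⇒ (suc i₂ , j₂) b p))
      where
      j≥1 : 1 ≤ j₂
      j≥1 = proj₁ (proj₁ (skew-∈⁻ λ' α _ c∈cs))
      in-α : (suc i₂ ≡ suc i × j₂ < suc (row α i)) ⊎ (j₂ ≡ suc (row α i) × suc i₂ < suc i) → j₂ ≤ row α i₂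
      in-α (inj₁ (e , lt))     = subst (λ z → j₂ ≤ row α z) (sym (suc-injective e)) (≤-pred lt)
      in-α (inj₂ (e , s≤s lt)) = above i lt ok e
        where
        above : ∀ i → i₂ < i → T (addable α i) → j₂ ≡ suc (row α i) → j₂ ≤ row α i₂
        above (suc i') (s≤s l) ok e = subst (_≤ row α i₂) (sym e) (≤-trans (<ᵇ⇒< _ _ ok) (row-mono α dα l))

  minimal-cells : bfilter minimal cs ↭ map (newCell α) fittingRows
  minimal-cells = unique-↭ (unique-bfilter _ (unique-skew λ' α))
    (UniqueP.map⁺ (λ e → suc-injective (cong proj₁ e)) (unique-bfilter _ (unique-addableRows α)))
    to from
    where
    to : ∀ b → b ∈ bfilter minimal cs → b ∈ map (newCell α) fittingRows
    to b p with ∈-bfilter⁻ minimal cs p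
    ... | b∈ , m with minimal⇒newCell b b∈ m
    ... | i , i∈ , refl = ∈-map⁺ (newCell α) i∈
    from : ∀ b → b ∈ map (newCell α) fittingRows → b ∈ bfilter minimal cs
    from b p with ∈-map⁻ (newCell α) p
    ... | i , i∈ , refl = let (b∈ , m) = newCell⇒minimal i i∈ in ∈-bfilter⁺ minimal cs b∈ m

module FirstCell (α λ' : List ℕ) (dα : Decreasing α) (pα : Positive α) (dλ : Decreasing λ') (α⊆λ : α ⊆ λ')
                 (L : ℕ) (skew-size : length (skewCells λ' α) ≡ suc L) where

  open MinimalCells α λ' dα dλ α⊆λ

  permsL : List (List ℕ)
  permsL = perms (range 1 L)

  K : Cell → ℤ
  K b = negOnePow (count (_◁ b) (remove b cs) + count (b ◁_) (cells α))
          ℤ.* ℤΣ.∑ (λ τ → weight α (zip (remove b cs) τ)) permsL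

  length-remove-cs : ∀ {b} → b ∈ cs → length (remove b cs) ≡ L
  length-remove-cs b∈ = suc-injective (trans (length-remove _ cs (unique-skew λ' α) b∈) skew-size)

  fillings-with-1-at : ∀ b → b ∈ cs →
    ℤΣ.∑ (λ τ → weight α ((b , 1) ∷ zip (remove b cs) (map suc τ))) permsL ≡ ℤΣ.when (minimal b) (K b)
  fillings-with-1-at b b∈ = begin
    ℤΣ.∑ (λ τ → weight α ((b , 1) ∷ zip (remove b cs) (map suc τ))) permsL
      ≡⟨ ℤΣ.∑-cong permsL (λ τ τ∈ → weight-put-1 α b (remove b cs) τ
           (trans (length-remove-cs b∈) (sym (perm-range-length L τ∈))) (perm-range-positive L τ∈)) ⟩
    ℤΣ.∑ (λ τ → ℤΣ.when (minimal b) (sign ℤ.* weight α (zip (remove b cs) τ))) permsL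
      ≡⟨ ℤΣ.∑-when (minimal b) (λ τ → sign ℤ.* weight α (zip (remove b cs) τ)) permsL ⟩
    ℤΣ.when (minimal b) (ℤΣ.∑ (λ τ → sign ℤ.* weight α (zip (remove b cs) τ)) permsL)
      ≡⟨ cong (ℤΣ.when (minimal b)) (ℤ*-∑ sign (λ τ → weight α (zip (remove b cs) τ)) permsL) ⟩
    ℤΣ.when (minimal b) (K b) ∎
    where
    sign : ℤ
    sign = negOnePow (count (_◁ b) (remove b cs) + count (b ◁_) (cells α))

  K-newCell : ∀ i → (le : i ≤ length α) → newCell α i ∈ cs →
    K (newCell α i) ≡ negOnePow (u (addCell α i) α) ℤ.* I λ' (addCell α i)
  K-newCell i le b∈ = begin
    negOnePow (cL + cb) ℤ.* S
      ≡⟨ cong (ℤ._* S) (trans (negOnePow-+ cL cb) (ℤP.*-comm (negOnePow cL) (negOnePow cb))) ⟩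
    (negOnePow cb ℤ.* negOnePow cL) ℤ.* S
      ≡⟨ ℤP.*-assoc (negOnePow cb) (negOnePow cL) S ⟩
    negOnePow cb ℤ.* (negOnePow cL ℤ.* S)
      ≡⟨ cong₂ ℤ._*_ (cong negOnePow (sym u-addCell)) (sym I-ν) ⟩
    negOnePow (u ν α) ℤ.* I λ' ν ∎
    where
    open AddedCell α i le
    r : List Cell
    r = remove b cs
    cL : ℕ
    cL = count (_◁ b) r
    cb : ℕ
    cb = count (b ◁_) (cells α)
    S : ℤ
    S = ℤΣ.∑ (λ τ → weight α (zip r τ)) permsL
    I-ν : I λ' ν ≡ negOnePow cL ℤ.* S
    I-ν = begin
      I λ' ν
        ≡⟨ I-as-∑ λ' ν ⟩
      ℤΣ.∑ (λ σ → weight ν (zip (skewCells λ' ν) σ)) (perms (range 1 (length (skewCells λ' ν))))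
        ≡⟨ cong (λ l → ℤΣ.∑ (λ σ → weight ν (zip l σ)) (perms (range 1 (length l)))) (sym (remove-skew λ')) ⟩
      ℤΣ.∑ (λ σ → weight ν (zip r σ)) (perms (range 1 (length r)))
        ≡⟨ cong (λ n → ℤΣ.∑ (λ σ → weight ν (zip r σ)) (perms (range 1 n))) (length-remove-cs b∈) ⟩
      ℤΣ.∑ (λ σ → weight ν (zip r σ)) permsL
        ≡⟨ ℤΣ.∑-cong permsL (λ τ τ∈ → trans (weight-addCell α i le (zip r τ))
             (cong (λ l → negOnePow (count (_◁ b) l) ℤ.* weight α (zip r τ))
                   (map-proj₁-zip r τ (trans (length-remove-cs b∈) (sym (perm-range-length L τ∈)))))) ⟩
      ℤΣ.∑ (λ τ → negOnePow cL ℤ.* weight α (zip r τ)) permsL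
        ≡⟨ ℤ*-∑ (negOnePow cL) (λ τ → weight α (zip r τ)) permsL ⟩
      negOnePow cL ℤ.* S ∎

  G : List ℕ → ℤ
  G ν = ℤΣ.when (ν ⊆ᵇ λ') (negOnePow (u ν α) ℤ.* I λ' ν)

  first-cell-recursion : I λ' α ≡ ℤΣ.∑ G (plus α)
  first-cell-recursion = begin
    I λ' α
      ≡⟨ I-by-cell-of-1 λ' α L skew-size ⟩
    ℤΣ.∑ (λ b → ℤΣ.∑ (λ τ → weight α ((b , 1) ∷ zip (remove b cs) (map suc τ))) permsL) cs
      ≡⟨ ℤΣ.∑-cong cs fillings-with-1-at ⟩
    ℤΣ.∑ (λ b → ℤΣ.when (minimal b) (K b)) cs
      ≡⟨ sym (ℤΣ.∑-bfilter K minimal cs) ⟩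
    ℤΣ.∑ K (bfilter minimal cs)
      ≡⟨ ℤΣ.∑-↭ K minimal-cells ⟩
    ℤΣ.∑ K (map (newCell α) fittingRows)
      ≡⟨ ℤΣ.∑-map K (newCell α) fittingRows ⟩
    ℤΣ.∑ (λ i → K (newCell α i)) fittingRows
      ≡⟨ ℤΣ.∑-cong fittingRows (λ i i∈ →
           K-newCell i (proj₁ (addableRows-∈⁻ α (proj₁ (∈-bfilter⁻ _ (addableRows α) i∈))))
                       (proj₁ (newCell⇒minimal i i∈))) ⟩
    ℤΣ.∑ (λ i → negOnePow (u (addCell α i) α) ℤ.* I λ' (addCell α i)) fittingRows
      ≡⟨ ℤΣ.∑-bfilter _ (λ i → addCell α i ⊆ᵇ λ') (addableRows α) ⟩
    ℤΣ.∑ (λ i → G (addCell α i)) (addableRows α)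
      ≡⟨ sym (ℤΣ.∑-map G (addCell α) (addableRows α)) ⟩
    ℤΣ.∑ G (map (addCell α) (addableRows α))
      ≡⟨ sym (ℤΣ.∑-↭ G (plus↭addCell α dα pα)) ⟩
    ℤΣ.∑ G (plus α) ∎

vhd : List ℕ → List ℕ → Exp
vhd λ' μ = (vS λ' μ , hS λ' μ , dS λ' μ)

_+ᵉ_ : Exp → Exp → Exp
(a , b , c) +ᵉ (a' , b' , c') = (a + a' , b + b' , c + c')

_==ᵉ_ : Exp → Exp → Bool
(a , b , c) ==ᵉ (a' , b' , c') = (a ≡ᵇ a') ∧ (b ≡ᵇ b') ∧ (c ≡ᵇ c')

vhd-split : ∀ α ν λ' → α ⊆ ν → ν ⊆ λ' → vhd ν α +ᵉ vhd λ' ν ≡ vhd λ' α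
vhd-split α ν λ' α⊆ν ν⊆λ = cong₂ _,_ (split _) (cong₂ _,_ (split _) (split _))
  where
  split : ∀ p → count p (skewCells ν α) + count p (skewCells λ' ν) ≡ count p (skewCells λ' α)
  split = count-skew-split α ν λ' α⊆ν ν⊆λ

coeff-∑ : ∀ p e → coeff p e ≡ ℤΣ.∑ (λ t → ℤΣ.when (e ==ᵉ proj₂ t) (proj₁ t)) p
coeff-∑ p e = trans (foldr-ℤ _ p) (ℤΣ.∑-ext p (λ t → refl))

coeff-F : ∀ m α e → coeff (F m α) e ≡ ℤΣ.∑ (λ λ' → ℤΣ.when (e ==ᵉ vhd λ' α) (I λ' α)) (shapes α m)
coeff-F m α e = trans (coeff-∑ (F m α) e) (ℤΣ.∑-map _ _ (shapes α m))

coeff-RHS : ∀ n α e → coeff (RHS n α) e ≡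
  ℤΣ.∑ (λ ν → ℤΣ.∑ (λ λ' → ℤΣ.when (e ==ᵉ (vhd ν α +ᵉ vhd λ' ν)) (negOnePow (u ν α) ℤ.* I λ' ν)) (shapes ν n)) (plus α)
coeff-RHS n α e = trans (coeff-∑ (RHS n α) e)
  (trans (ℤΣ.∑-concatMap _ _ (plus α))
   (ℤΣ.∑-ext (plus α) (λ ν → trans (ℤΣ.∑-map _ _ (F n ν)) (ℤΣ.∑-map _ _ (shapes ν n)))))

nonempty-skew : ∀ α λ' → α ⊆ λ' → sum α < sum λ' → Σ ℕ λ L → length (skewCells λ' α) ≡ suc L
nonempty-skew α λ' α⊆λ lt = let (k , q) = longer-row α λ' α⊆λ lt in
  nonempty (skew-∈⁺ λ' α (suc k , row λ' k) (≤-trans (s≤s z≤n) q , ≤-refl) (λ x → <-irrefl refl (≤-trans q (proj₂ x))))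
  where
  longer-row : ∀ α λ' → α ⊆ λ' → sum α < sum λ' → Σ ℕ λ k → row α k < row λ' k
  longer-row α        []            s ()
  longer-row []       (suc l ∷ ls) s lt = 0 , s≤s z≤n
  longer-row []       (zero ∷ ls)  s lt = let (k , q) = longer-row [] ls (λ k → z≤n) lt in suc k , q
  longer-row (a ∷ as) (l ∷ ls)     s lt with m≤n⇒m<n∨m≡n (s 0)
  ... | inj₁ a<l  = 0 , a<l
  ... | inj₂ refl = let (k , q) = longer-row as ls (λ k → s (suc k)) (+-cancelˡ-< a _ _ lt) in suc k , q
  nonempty : ∀ {l : List Cell} {c} → c ∈ l → Σ ℕ λ L → length l ≡ suc L
  nonempty {x ∷ xs} _ = length xs , refl

coefficient-at : ∀ α → Decreasing α → Positive α → ∀ n e λ' → λ' ∈ partitionsOf (sum α + suc n) →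
  ℤΣ.when (α ⊆ᵇ λ') (ℤΣ.when (e ==ᵉ vhd λ' α) (I λ' α))
    ≡ ℤΣ.∑ (λ ν → ℤΣ.when (ν ⊆ᵇ λ') (ℤΣ.when (e ==ᵉ (vhd ν α +ᵉ vhd λ' ν)) (negOnePow (u ν α) ℤ.* I λ' ν))) (plus α)
coefficient-at α dα pα n e λ' λ∈ with partsB-∈⁻ _ _ _ λ' ≤-refl λ∈ | α ⊆ᵇ λ' in α⊆ᵇλ
... | _ | false = sym (ℤΣ.∑-vanish (plus α) (λ ν ν∈ → when-false _ (λ ν⊆λ →
        subst T α⊆ᵇλ (⊆⇒⊆ᵇ α λ' (⊆-trans {α} {ν} {λ'} (proj₁ (plus-∈⁻ α ν ν∈)) (⊆ᵇ⇒⊆ ν λ' ν⊆λ))))))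
... | (dλ , _ , size-λ , _) | true = sym (begin
  ℤΣ.∑ (λ ν → ℤΣ.when (ν ⊆ᵇ λ') (ℤΣ.when (e ==ᵉ (vhd ν α +ᵉ vhd λ' ν)) (term ν))) (plus α)
    ≡⟨ ℤΣ.∑-cong (plus α) (λ ν ν∈ → exponent-of-λ ν (proj₁ (plus-∈⁻ α ν ν∈))) ⟩
  ℤΣ.∑ (λ ν → ℤΣ.when (e ==ᵉ vhd λ' α) (G ν)) (plus α)
    ≡⟨ ℤΣ.∑-when (e ==ᵉ vhd λ' α) G (plus α) ⟩
  ℤΣ.when (e ==ᵉ vhd λ' α) (ℤΣ.∑ G (plus α))
    ≡⟨ cong (ℤΣ.when (e ==ᵉ vhd λ' α)) (sym first-cell-recursion) ⟩
  ℤΣ.when (e ==ᵉ vhd λ' α) (I λ' α) ∎)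
  where
  α⊆λ : α ⊆ λ'
  α⊆λ = ⊆ᵇ⇒⊆ α λ' (subst T (sym α⊆ᵇλ) tt)
  α<λ : sum α < sum λ'
  α<λ = subst (sum α <_) (sym size-λ) (subst (suc (sum α) ≤_) (sym (+-suc (sum α) n)) (s≤s (m≤m+n (sum α) n)))
  L,size : Σ ℕ λ L → length (skewCells λ' α) ≡ suc L
  L,size = nonempty-skew α λ' α⊆λ α<λ
  open FirstCell α λ' dα pα dλ α⊆λ (proj₁ L,size) (proj₂ L,size)
  term : List ℕ → ℤ
  term ν = negOnePow (u ν α) ℤ.* I λ' ν
  exponent-of-λ : ∀ ν → α ⊆ ν →
    ℤΣ.when (ν ⊆ᵇ λ') (ℤΣ.when (e ==ᵉ (vhd ν α +ᵉ vhd λ' ν)) (term ν)) ≡ ℤΣ.when (e ==ᵉ vhd λ' α) (G ν)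
  exponent-of-λ ν α⊆ν with ν ⊆ᵇ λ' in ν⊆ᵇλ
  ... | true  = cong (λ d → ℤΣ.when (e ==ᵉ d) (term ν)) (vhd-split α ν λ' α⊆ν (⊆ᵇ⇒⊆ ν λ' (subst T (sym ν⊆ᵇλ) tt)))
  ... | false = sym (when-zero (e ==ᵉ vhd λ' α))

proposition4p6 : (α : List ℕ) → IsPartition α → (n : ℕ) →
    F (suc n) α ≈P RHS n α
proposition4p6 α (dα , pα) n e = begin
  coeff (F (suc n) α) e
    ≡⟨ coeff-F (suc n) α e ⟩
  ℤΣ.∑ (λ λ' → ℤΣ.when (e ==ᵉ vhd λ' α) (I λ' α)) (bfilter (α ⊆ᵇ_) P)
    ≡⟨ ℤΣ.∑-bfilter _ (α ⊆ᵇ_) P ⟩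
  ℤΣ.∑ (λ λ' → ℤΣ.when (α ⊆ᵇ λ') (ℤΣ.when (e ==ᵉ vhd λ' α) (I λ' α))) P
    ≡⟨ ℤΣ.∑-cong P (coefficient-at α dα pα n e) ⟩
  ℤΣ.∑ (λ λ' → ℤΣ.∑ (λ ν → ℤΣ.when (ν ⊆ᵇ λ') (g ν λ')) (plus α)) P
    ≡⟨ ℤΣ.∑-swap (λ λ' ν → ℤΣ.when (ν ⊆ᵇ λ') (g ν λ')) P (plus α) ⟩
  ℤΣ.∑ (λ ν → ℤΣ.∑ (λ λ' → ℤΣ.when (ν ⊆ᵇ λ') (g ν λ')) P) (plus α)
    ≡⟨ ℤΣ.∑-cong (plus α) (λ ν ν∈ → sym (trans (cong (λ N → ℤΣ.∑ (g ν) (bfilter (ν ⊆ᵇ_) (partitionsOf N))) (size-ν ν∈))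
                                                 (ℤΣ.∑-bfilter (g ν) (ν ⊆ᵇ_) P))) ⟩
  ℤΣ.∑ (λ ν → ℤΣ.∑ (g ν) (shapes ν n)) (plus α)
    ≡⟨ sym (coeff-RHS n α e) ⟩
  coeff (RHS n α) e ∎
  where
  P : List (List ℕ)
  P = partitionsOf (sum α + suc n)
  g : List ℕ → List ℕ → ℤ
  g ν λ' = ℤΣ.when (e ==ᵉ (vhd ν α +ᵉ vhd λ' ν)) (negOnePow (u ν α) ℤ.* I λ' ν)
  size-ν : ∀ {ν} → ν ∈ plus α → sum ν + n ≡ sum α + suc n
  size-ν {ν} ν∈ = trans (cong (_+ n) (proj₂ (plus-∈⁻ α ν ν∈))) (+-assoc (sum α) 1 n)
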